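{- Let $2\le p_1\le p_2\le p_3\le p_4$ be integers and $n>3(p_1-2)+\sum_{i=2}^4 p_i(p_i+1)$. Let $G$ be an $n$-vertex $K_{p_1}\cup K_{p_2}\cup K_{p_3}\cup K_{p_4}$-saturated graph with $e(G)\le e(H(n;p_1,p_2,p_3,p_4))$. Let $v$ be a vertex of minimum degree in $G$, let $S=N_G(v)$, and let $w\in V(G)\setminus(S\cup\{v\})$. Let $H_{vw}=H_{vw,1}\cup H_{vw,2}\cup H_{vw,3}$ be a subgraph of $G[V(G)\setminus(S\cup\{v,w\})]$ consisting of vertex-disjoint complete graphs with $H_{vw,i}\cong K_{p_{i+1}}$ for $i\in\{1,2,3\}$. Let $i\in\{1,2,3\}$ and $x\in V(H_{vw,i})$, and let $H_{vx}=H_{vx,1}\cup H_{vx,2}\cup H_{vx,3}$ be a subgraph of $G[V(G)\setminus(S\cup\{v,x\})]$ consisting of vertex-disjoint complete graphs with $H_{vx,j}\cong K_{p_{j+1}}$ for $j\in\{1,2,3\}$. For $1\le a,b\le 3$ let $\ell_{ab}=|V(H_{vx,a})\cap V(H_{vw,b})|$. Then (i) $p_{j+1}-1\le \ell_{j1}+\ell_{j2}+\ell_{j3}\le p_{j+1}$ for all $1\le j\le 3$; (ii) $p_{j+1}-1\le \ell_{1j}+\ell_{2j}+\ell_{3j}\le p_{j+1}$ for all $j\in\{1,2,3\}\setminus\{i\}$; (iii) $\ell_{1i}+\ell_{2i}+\ell_{3i}=p_{i+1}-1$. Moreover, if $|V(H_{vx})\setminus V(H_{vw})|=1$, then $\ell_{1k}+\ell_{2k}+\ell_{3k}=p_{k+1}$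 for every $k\in\{1,2,3\}\setminus\{i\}$.
   Context: All graphs are finite and simple; $e(G)$ is the number of edges, $N_G(v)$ the neighborhood of $v$, and $G[X]$ the subgraph induced by $X$. $K_m$ is the complete graph and $I_m$ the edgeless graph on $m$ vertices; $\cup$ is vertex-disjoint union and $\lor$ is the join (add all edges between the two parts). $H(n;p_1,\dots,p_t)=K_{p_1-2}\lor\bigl(K_{p_2+1}\cup\dots\cup K_{p_t+1}\cup I_{n-t+3-\sum_{i=1}^t p_i}\bigr)$. A graph $G$ is $F$-saturated if $G$ has no subgraph isomorphic to $F$ but $G+uv$ has one for every pair of nonadjacent vertices $u,v$. -}

module Defs where

open import Data.Nat using (ℕ; _+_; _∸_)
open import Data.Bool using (Bool; true; false; not; _∧_; _∨_; if_then_else_)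
open import Data.Fin using (Fin; splitAt; _<?_; _≟_) renaming (zero to fz; suc to fs)
open import Data.Fin.Subset using (Subset; _∈_; _∉_; ∣_∣)
open import Data.Sum using (inj₁; inj₂)
open import Data.List using (List; map; allFin)
open import Data.Nat.ListAction using (sum)
open import Data.Vec using (tabulate)
open import Data.Product using (Σ; _×_)
open import Function.Definitions using (Injective)
open import Relation.Nullary using (¬_)
open import Relation.Nullary.Decidable using (⌊_⌋)
open import Relation.Binary.PropositionalEquality using (_≡_; _≢_)

Graph : ℕ → Set
Graph n = Fin n → Fin n → Bool

IsSimple : {n : ℕ} → Graph n → Set
IsSimple {n} G = ((a b : Fin n) → G a b ≡ G b a) × ((a : Fin n) → G a a ≡ false)

e : {n : ℕ} → Graph n → ℕ
e {n} G = sum (map (λ a → sum (map (λ b → if ⌊ a <? b ⌋ ∧ G a b then 1 else 0) (allFin n))) (allFin n))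

deg : {n : ℕ} → Graph n → Fin n → ℕ
deg {n} G v = sum (map (λ b → if G v b then 1 else 0) (allFin n))

N : {n : ℕ} → Graph n → Fin n → Subset n
N G v = tabulate (G v)

K : (m : ℕ) → Graph m
K m a b = not ⌊ a ≟ b ⌋

I : (m : ℕ) → Graph m
I m a b = false

_⊎G_ : {m k : ℕ} → Graph m → Graph k → Graph (m + k)
_⊎G_ {m} G H a b with splitAt m a | splitAt m b
... | inj₁ x | inj₁ y = G x y
... | inj₂ x | inj₂ y = H x y
... | _ | _ = false

_∨G_ : {m k : ℕ} → Graph m → Graph k → Graph (m + k)
_∨G_ {m} G H a b with splitAt m a | splitAt m b
... | inj₁ x | inj₁ y = G x y
... | inj₂ x | inj₂ y = H x y
... | _ | _ = not ⌊ a ≟ b ⌋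

infixr 5 _⊎G_
infixr 4 _∨G_

addEdge : {n : ℕ} → Graph n → Fin n → Fin n → Graph n
addEdge G u v a b = G a b ∨ ((⌊ a ≟ u ⌋ ∧ ⌊ b ≟ v ⌋) ∨ (⌊ a ≟ v ⌋ ∧ ⌊ b ≟ u ⌋))

Contains : {m n : ℕ} → Graph m → Graph n → Set
Contains {m} {n} F G =
  Σ (Fin m → Fin n) λ f → Injective _≡_ _≡_ f × ((a b : Fin m) → F a b ≡ true → G (f a) (f b) ≡ true)

Saturated : {m n : ℕ} → Graph m → Graph n → Set
Saturated {m} {n} F G =
  ¬ Contains F G × ((u v : Fin n) → u ≢ v → G u v ≡ false → Contains F (addEdge G u v))

Hgraph : (n p1 p2 p3 p4 : ℕ) → Graph _
Hgraph n p1 p2 p3 p4 =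
  K (p1 ∸ 2) ∨G (K (p2 + 1) ⊎G K (p3 + 1) ⊎G K (p4 + 1) ⊎G I (((n + 3) ∸ 4) ∸ (p1 + p2 + p3 + p4)))

F4 : (p1 p2 p3 p4 : ℕ) → Graph _
F4 p1 p2 p3 p4 = K p1 ⊎G K p2 ⊎G K p3 ⊎G K p4

-- p_{j+1} for j ∈ {1,2,3} (indexed by Fin 3: fz ↦ p2, fs fz ↦ p3, fs (fs fz) ↦ p4)
q : (p2 p3 p4 : ℕ) → Fin 3 → ℕ
q p2 p3 p4 fz = p2
q p2 p3 p4 (fs fz) = p3
q p2 p3 p4 (fs (fs fz)) = p4

IsClique : {n : ℕ} → Graph n → Subset n → Set
IsClique {n} G X = (a b : Fin n) → a ∈ X → b ∈ X → a ≢ b → G a b ≡ true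

-- H : Fin 3 → Subset n describes vertex-disjoint complete graphs H_1,H_2,H_3 in G with
-- H_j ≅ K_{q j}, contained in G[V(G) \ (N(v) ∪ {v, y})]
CliqueFamily : {n : ℕ} → Graph n → (Fin 3 → ℕ) → Fin n → Fin n → (Fin 3 → Subset n) → Set
CliqueFamily {n} G sz v y H =
  ((j : Fin 3) → ∣ H j ∣ ≡ sz j × IsClique G (H j))
  × ((j k : Fin 3) → j ≢ k → (a : Fin n) → a ∈ H j → a ∉ H k)
  × ((j : Fin 3) → (a : Fin n) → a ∈ H j → a ∉ N G v × a ≢ v × a ≢ y)

-- Saturation gives every non-neighbour u ≠ v of v a clique of p1 - 2 common neighbours with v.
-- Counting the degree sum of G with these cliques and with the minimum degree, against
-- 2e(G) ≤ 2e(H), forces deg v ≤ p1 - 2; so such a clique is all of S = N(v), and S is joined to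
-- every vertex outside N[v]. Two adjacent vertices outside N[v] ∪ V(H_vw) would then span, with S,
-- a K_{p1} disjoint from H_vw, i.e. a copy of K_{p1} ∪ K_{p2} ∪ K_{p3} ∪ K_{p4} in G. Hence every
-- clique of H_vx has at most one vertex outside V(H_vw) and vice versa (x being such a vertex of
-- H_vw,i), and the bounds follow by counting the rows and columns of (ℓ_ab).

module Submission where

open import Defs
open import Data.Bool using (Bool; true; false; not; _∧_; _∨_; if_then_else_)
import Data.Bool.Properties as Bool
open import Data.Bool.Properties using (∧-zeroʳ; ∧-identityʳ; ∧-idem)
open import Data.Empty using (⊥)
open import Data.Fin using (Fin; _≟_; _<?_; splitAt; _↑ˡ_; _↑ʳ_; punchIn; punchOut; inject≤)
  renaming (zero to fz; suc to fs)
open import Data.Fin.Properties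
  using (suc-injective; 0≢1+n; any?; <-cmp; splitAt-↑ˡ; splitAt-↑ʳ; splitAt⁻¹-↑ˡ; splitAt⁻¹-↑ʳ; ↑ˡ-injective; ↑ʳ-injective;
         punchIn-injective; punchInᵢ≢i; punchIn-punchOut; inject≤-injective)
open import Data.Fin.Subset using (Subset; _∈_; _∉_; _∩_; _∪_; _─_; ∣_∣)
open import Data.Fin.Subset.Properties using (x∈p∪q⁻; x∈p∪q⁺; p─q⊆p; ∩-comm; x∈p∧x∉q⇒x∈p─q; x∈p⇒∣p-x∣<∣p∣)
open import Data.List using (allFin) renaming (map to mapL; tabulate to tabulateL)
open import Data.List.Properties using (map-tabulate)
open import Data.Nat using (ℕ; zero; suc; _+_; _*_; _∸_; _≤_; _<_; z≤n; s≤s; _≤?_)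
open import Data.Nat.ListAction using () renaming (sum to sumL)
open import Data.Nat.Properties hiding (_≟_; _<?_; <-cmp; suc-injective; 0≢1+n)
open import Algebra.Properties.Semiring.Sum +-*-semiring
  using (sum; sum-syntax; ∑-distrib-+; ∑-comm; sum-cong-≗; *-distribʳ-sum)
open import Data.Nat.Tactic.RingSolver using (solve-∀)
open import Data.Product using (Σ; _×_; _,_; proj₁; proj₂)
open import Data.Sum using (_⊎_; inj₁; inj₂)
open import Data.Vec using ([]; _∷_; lookup; here; there)
import Data.Vec.Functional as Vector
open import Data.Vec.Properties using (lookup-zipWith; lookup⇒[]=; lookup∘tabulate)
open import Function using (_∘_; id)
open import Function.Definitions using (Injective)
open import Relation.Binary using (tri<; tri≈; tri>)
open import Relation.Binary.PropositionalEquality hiding ([_])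
open import Relation.Nullary using (¬_; Dec; yes; no; contradiction)
open import Relation.Nullary.Decidable using (⌊_⌋; ⌊⌋-map′; isYes≗does; dec-true; dec-false; _×-dec_)

private variable
  m n k : ℕ

-- Finite sums and counting

sum-const : ∀ n c → ∑[ i < n ] c ≡ n * c
sum-const zero    c = refl
sum-const (suc n) c = cong (c +_) (sum-const n c)

sum-mono-≤ : {f g : Fin n → ℕ} → (∀ i → f i ≤ g i) → sum f ≤ sum g
sum-mono-≤ {zero}  f≤g = z≤n
sum-mono-≤ {suc n} f≤g = +-mono-≤ (f≤g fz) (sum-mono-≤ (f≤g ∘ fs))

sum-↑ : (f : Fin (m + k) → ℕ) → sum f ≡ ∑[ i < m ] f (i ↑ˡ k) + ∑[ j < k ] f (m ↑ʳ j)
sum-↑ {zero}  f = refl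
sum-↑ {suc m} {k} f = trans (cong (f fz +_) (sum-↑ {m} {k} (f ∘ fs))) (sym (+-assoc (f fz) _ _))

listSum-allFin : (f : Fin n → ℕ) → sumL (mapL f (allFin n)) ≡ sum f
listSum-allFin {n} f = trans (cong sumL (map-tabulate id f)) (sumL-tabulate f)
  where
  sumL-tabulate : ∀ {n} (g : Fin n → ℕ) → sumL (tabulateL g) ≡ sum g
  sumL-tabulate {zero}  g = refl
  sumL-tabulate {suc n} g = cong (g fz +_) (sumL-tabulate (g ∘ fs))

[_] : Bool → ℕ
[ true ]  = 1
[ false ] = 0

if-10≡[] : ∀ b → (if b then 1 else 0) ≡ [ b ]
if-10≡[] true  = refl
if-10≡[] false = refl

count : (Fin n → Bool) → ℕ
count {n} T = ∑[ b < n ] [ T b ]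

count-false : count {n} (λ _ → false) ≡ 0
count-false {n} = trans (sum-const n 0) (*-zeroʳ n)

count-true : count {n} (λ _ → true) ≡ n
count-true {n} = trans (sum-const n 1) (*-identityʳ n)

⌊⌋-yes : ∀ {p} {P : Set p} (P? : Dec P) → P → ⌊ P? ⌋ ≡ true
⌊⌋-yes P? p = trans (isYes≗does P?) (dec-true P? p)

⌊⌋-no : ∀ {p} {P : Set p} (P? : Dec P) → ¬ P → ⌊ P? ⌋ ≡ false
⌊⌋-no P? ¬p = trans (isYes≗does P?) (dec-false P? ¬p)

⌊≟⌋-refl : (a : Fin n) → ⌊ a ≟ a ⌋ ≡ true
⌊≟⌋-refl a = ⌊⌋-yes (a ≟ a) refl

⌊≟⌋-≢ : {a b : Fin n} → a ≢ b → ⌊ a ≟ b ⌋ ≡ false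
⌊≟⌋-≢ {a = a} {b} = ⌊⌋-no (a ≟ b)

⌊≟⌋-sym : (a b : Fin n) → ⌊ a ≟ b ⌋ ≡ ⌊ b ≟ a ⌋
⌊≟⌋-sym a b with a ≟ b
... | yes refl = sym (⌊≟⌋-refl a)
... | no  a≢b  = sym (⌊≟⌋-≢ (a≢b ∘ sym))

count-singleton : (x : Fin n) → count (λ b → ⌊ x ≟ b ⌋) ≡ 1
count-singleton {suc n} fz      = cong suc (count-false {n})
count-singleton {suc n} (fs x) =
  trans (sum-cong-≗ (λ b → cong [_] (⌊⌋-map′ (cong fs) suc-injective (x ≟ b))))
        (count-singleton x)

count-mono : {T U : Fin n → Bool} → (∀ b → T b ≡ true → U b ≡ true) → count T ≤ count U
count-mono {T = T} {U} T⊆U = sum-mono-≤ pointwise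
  where
  pointwise : ∀ b → [ T b ] ≤ [ U b ]
  pointwise b with T b in Tb
  ... | false = z≤n
  ... | true  rewrite T⊆U b Tb = ≤-refl

remove : (Fin n → Bool) → Fin n → Fin n → Bool
remove T x b = T b ∧ not ⌊ x ≟ b ⌋

count-remove : (T : Fin n → Bool) {x : Fin n} → T x ≡ true → count T ≡ suc (count (remove T x))
count-remove {n} T {x} Tx = begin
  count T                                                 ≡⟨ sum-cong-≗ pointwise ⟩
  ∑[ b < n ] ([ ⌊ x ≟ b ⌋ ] + [ remove T x b ])           ≡⟨ ∑-distrib-+ {n} _ _ ⟩
  count (λ b → ⌊ x ≟ b ⌋) + count (remove T x)            ≡⟨ cong (_+ count (remove T x)) (count-singleton x) ⟩
  suc (count (remove T x))                                ∎
  where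
  open ≡-Reasoning
  pointwise : ∀ b → [ T b ] ≡ [ ⌊ x ≟ b ⌋ ] + [ remove T x b ]
  pointwise b with x ≟ b
  ... | yes refl rewrite Tx = refl
  ... | no  _    with T b
  ...   | true  = refl
  ...   | false = refl

count-injection : (T : Fin n → Bool) (h : Fin m → Fin n) → Injective _≡_ _≡_ h →
                  (∀ c → T (h c) ≡ true) → m ≤ count T
count-injection {m = zero}  T h h-inj Th = z≤n
count-injection {m = suc m} T h h-inj Th =
  subst (suc m ≤_) (sym (count-remove T (Th fz)))
    (s≤s (count-injection (remove T (h fz)) (h ∘ fs) (suc-injective ∘ h-inj) Th∘fs))
  where
  Th∘fs : ∀ c → remove T (h fz) (h (fs c)) ≡ true
  Th∘fs c rewrite Th (fs c) | ⌊≟⌋-≢ {a = h fz} {h (fs c)} (0≢1+n ∘ h-inj) = refl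

-- An injection into T that misses x would be an injection into T minus x.
count-injection-onto : (T : Fin n → Bool) (h : Fin m → Fin n) → Injective _≡_ _≡_ h →
                       (∀ c → T (h c) ≡ true) → count T ≤ m →
                       ∀ x → T x ≡ true → Σ (Fin m) λ c → h c ≡ x
count-injection-onto {m = m} T h h-inj Th count≤m x Tx with any? (λ c → h c ≟ x)
... | yes hit = hit
... | no  miss = contradiction count≤m (<⇒≱ (begin-strict
      m                          ≤⟨ count-injection (remove T x) h h-inj Th∖x ⟩
      count (remove T x)         <⟨ n<1+n _ ⟩
      suc (count (remove T x))   ≡⟨ count-remove T Tx ⟨
      count T                    ∎))
  where
  open ≤-Reasoning
  Th∖x : ∀ c → remove T x (h c) ≡ true
  Th∖x c rewrite Th c | ⌊≟⌋-≢ (λ x≡hc → miss (c , sym x≡hc)) = refl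

count≤1 : (T : Fin n → Bool) → (∀ y z → T y ≡ true → T z ≡ true → y ≡ z) → count T ≤ 1
count≤1 {n} T unique with any? (λ y → T y Bool.≟ true)
... | yes (y , Ty) = subst (count T ≤_) (count-singleton y)
                       (count-mono λ z Tz → subst (λ u → ⌊ y ≟ u ⌋ ≡ true) (unique y z Ty Tz) (⌊≟⌋-refl y))
... | no  empty    = m≤n⇒m≤1+n (subst (count T ≤_) (count-false {n})
                       (count-mono {U = λ _ → false} λ z Tz → contradiction (z , Tz) empty))

-- Subsets

∣∣≡count : (X : Subset n) → ∣ X ∣ ≡ count (lookup X)
∣∣≡count []          = refl
∣∣≡count (true ∷ X)  = cong suc (∣∣≡count X)
∣∣≡count (false ∷ X) = ∣∣≡count X

∣∣≡count-of : (X : Subset n) (T : Fin n → Bool) → (∀ b → lookup X b ≡ T b) → ∣ X ∣ ≡ count T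
∣∣≡count-of X T X≗T = trans (∣∣≡count X) (sum-cong-≗ (cong [_] ∘ X≗T))

∉⇒lookup : {X : Subset n} {x : Fin n} → x ∉ X → lookup X x ≡ false
∉⇒lookup {X = X} {x} x∉X with lookup X x in eq
... | true  = contradiction (lookup⇒[]= x X eq) x∉X
... | false = refl

lookup-∩ : (X Y : Subset n) (b : Fin n) → lookup (X ∩ Y) b ≡ lookup X b ∧ lookup Y b
lookup-∩ X Y b = lookup-zipWith _∧_ b X Y

lookup-∪ : (X Y : Subset n) (b : Fin n) → lookup (X ∪ Y) b ≡ lookup X b ∨ lookup Y b
lookup-∪ X Y b = lookup-zipWith _∨_ b X Y

lookup-─ : (X Y : Subset n) (b : Fin n) → lookup (X ─ Y) b ≡ lookup X b ∧ not (lookup Y b)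
lookup-─ (x ∷ X) (y ∷ Y) (fs b) = lookup-─ X Y b
lookup-─ (x ∷ X) (true  ∷ Y) fz = sym (∧-zeroʳ x)
lookup-─ (x ∷ X) (false ∷ Y) fz = sym (∧-identityʳ x)

Disjoint : Subset n → Subset n → Set
Disjoint {n} X Y = (b : Fin n) → b ∈ X → b ∉ Y

Disjoint⇒∧≡false : {X Y : Subset n} → Disjoint X Y → (b : Fin n) → lookup X b ∧ lookup Y b ≡ false
Disjoint⇒∧≡false {X = X} {Y} X∩Y=∅ b with lookup X b in Xb
... | false = refl
... | true  = ∉⇒lookup (X∩Y=∅ b (lookup⇒[]= b X Xb))

x∈p─q⇒x∉q : {X Y : Subset n} {x : Fin n} → x ∈ X ─ Y → x ∉ Y
x∈p─q⇒x∉q {X = _    ∷ _} {true ∷ _} () here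
x∈p─q⇒x∉q {X = _    ∷ _} {_    ∷ _} (there x∈X─Y) (there x∈Y) = x∈p─q⇒x∉q x∈X─Y x∈Y

∣∣≤1 : (X : Subset n) → (∀ y z → y ∈ X → z ∈ X → y ≡ z) → ∣ X ∣ ≤ 1
∣∣≤1 X unique = subst (_≤ 1) (sym (∣∣≡count X))
  (count≤1 (lookup X) λ y z Xy Xz → unique y z (lookup⇒[]= y X Xy) (lookup⇒[]= z X Xz))

lookup-⋃₃ : (X₀ X₁ X₂ : Subset n) (b : Fin n) → lookup (X₀ ∪ X₁ ∪ X₂) b ≡ lookup X₀ b ∨ lookup X₁ b ∨ lookup X₂ b
lookup-⋃₃ X₀ X₁ X₂ b = trans (lookup-∪ X₀ _ b) (cong (lookup X₀ b ∨_) (lookup-∪ X₁ X₂ b))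

sum₃ : (f g h : Fin n → ℕ) → ∑[ b < n ] (f b + g b + h b) ≡ sum f + sum g + sum h
sum₃ {n} f g h rewrite ∑-distrib-+ {n} (λ b → f b + g b) h | ∑-distrib-+ {n} f g = refl

sum₄ : (f g h k : Fin n → ℕ) → ∑[ b < n ] (f b + g b + h b + k b) ≡ sum f + sum g + sum h + sum k
sum₄ {n} f g h k rewrite ∑-distrib-+ {n} (λ b → f b + g b + h b) k
                       | ∑-distrib-+ {n} (λ b → f b + g b) h | ∑-distrib-+ {n} f g = refl

∣∩∣-partition : (A B₀ B₁ B₂ : Subset n) → Disjoint B₀ B₁ → Disjoint B₀ B₂ → Disjoint B₁ B₂ →
                ∣ A ∩ B₀ ∣ + ∣ A ∩ B₁ ∣ + ∣ A ∩ B₂ ∣ + ∣ A ─ (B₀ ∪ B₁ ∪ B₂) ∣ ≡ ∣ A ∣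
∣∩∣-partition {n} A B₀ B₁ B₂ B₀₁ B₀₂ B₁₂ = begin
  ∣ A ∩ B₀ ∣ + ∣ A ∩ B₁ ∣ + ∣ A ∩ B₂ ∣ + ∣ A ─ (B₀ ∪ B₁ ∪ B₂) ∣
    ≡⟨ cong₂ _+_ (cong₂ _+_ (cong₂ _+_ (∩≡ B₀) (∩≡ B₁)) (∩≡ B₂)) ─≡ ⟩
  ∑[ b < n ] [ a b ∧ b₀ b ] + ∑[ b < n ] [ a b ∧ b₁ b ] + ∑[ b < n ] [ a b ∧ b₂ b ]
    + ∑[ b < n ] [ a b ∧ not (b₀ b ∨ b₁ b ∨ b₂ b) ]
    ≡⟨ sum₄ (λ b → [ a b ∧ b₀ b ]) (λ b → [ a b ∧ b₁ b ]) (λ b → [ a b ∧ b₂ b ])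
            (λ b → [ a b ∧ not (b₀ b ∨ b₁ b ∨ b₂ b) ]) ⟨
  ∑[ b < n ] ([ a b ∧ b₀ b ] + [ a b ∧ b₁ b ] + [ a b ∧ b₂ b ] + [ a b ∧ not (b₀ b ∨ b₁ b ∨ b₂ b) ])
    ≡⟨ sum-cong-≗ (λ b → pointwise (a b) (b₀ b) (b₁ b) (b₂ b) (Disjoint⇒∧≡false B₀₁ b) (Disjoint⇒∧≡false B₀₂ b) (Disjoint⇒∧≡false B₁₂ b)) ⟩
  count a
    ≡⟨ ∣∣≡count A ⟨
  ∣ A ∣ ∎
  where
  open ≡-Reasoning
  a = lookup A; b₀ = lookup B₀; b₁ = lookup B₁; b₂ = lookup B₂
  ∩≡ : ∀ B → ∣ A ∩ B ∣ ≡ count (λ b → a b ∧ lookup B b)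
  ∩≡ B = ∣∣≡count-of (A ∩ B) _ (lookup-∩ A B)
  ─≡ : ∣ A ─ (B₀ ∪ B₁ ∪ B₂) ∣ ≡ count (λ b → a b ∧ not (b₀ b ∨ b₁ b ∨ b₂ b))
  ─≡ = ∣∣≡count-of (A ─ (B₀ ∪ B₁ ∪ B₂)) _ λ b → trans (lookup-─ A _ b) (cong (λ u → a b ∧ not u) (lookup-⋃₃ B₀ B₁ B₂ b))
  pointwise : ∀ x y₀ y₁ y₂ → y₀ ∧ y₁ ≡ false → y₀ ∧ y₂ ≡ false → y₁ ∧ y₂ ≡ false →
              [ x ∧ y₀ ] + [ x ∧ y₁ ] + [ x ∧ y₂ ] + [ x ∧ not (y₀ ∨ y₁ ∨ y₂) ] ≡ [ x ]
  pointwise false _     _     _     _  _  _  = refl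
  pointwise true  false false false _  _  _  = refl
  pointwise true  true  false false _  _  _  = refl
  pointwise true  false true  false _  _  _  = refl
  pointwise true  false false true  _  _  _  = refl
  pointwise true  true  true  _     () _  _
  pointwise true  true  false true  _  () _
  pointwise true  false true  true  _  _  ()

∣─∣-⋃₃ : (A₀ A₁ A₂ B : Subset n) → Disjoint A₀ A₁ → Disjoint A₀ A₂ → Disjoint A₁ A₂ →
         ∣ A₀ ─ B ∣ + ∣ A₁ ─ B ∣ + ∣ A₂ ─ B ∣ ≡ ∣ (A₀ ∪ A₁ ∪ A₂) ─ B ∣
∣─∣-⋃₃ {n} A₀ A₁ A₂ B A₀₁ A₀₂ A₁₂ = begin
  ∣ A₀ ─ B ∣ + ∣ A₁ ─ B ∣ + ∣ A₂ ─ B ∣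
    ≡⟨ cong₂ _+_ (cong₂ _+_ (─≡ A₀) (─≡ A₁)) (─≡ A₂) ⟩
  ∑[ b < n ] [ a₀ b ∧ not (β b) ] + ∑[ b < n ] [ a₁ b ∧ not (β b) ] + ∑[ b < n ] [ a₂ b ∧ not (β b) ]
    ≡⟨ trans (∑-distrib-+ {n} _ (λ b → [ a₂ b ∧ not (β b) ]))
             (cong (_+ ∑[ b < n ] [ a₂ b ∧ not (β b) ]) (∑-distrib-+ {n} _ _)) ⟨
  ∑[ b < n ] ([ a₀ b ∧ not (β b) ] + [ a₁ b ∧ not (β b) ] + [ a₂ b ∧ not (β b) ])
    ≡⟨ sum-cong-≗ (λ b → pointwise (a₀ b) (a₁ b) (a₂ b) (β b) (Disjoint⇒∧≡false A₀₁ b) (Disjoint⇒∧≡false A₀₂ b) (Disjoint⇒∧≡false A₁₂ b)) ⟩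
  count (λ b → (a₀ b ∨ a₁ b ∨ a₂ b) ∧ not (β b))
    ≡⟨ ∣∣≡count-of ((A₀ ∪ A₁ ∪ A₂) ─ B) _ (λ b → trans (lookup-─ (A₀ ∪ A₁ ∪ A₂) B b)
                                    (cong (_∧ not (β b)) (lookup-⋃₃ A₀ A₁ A₂ b))) ⟨
  ∣ (A₀ ∪ A₁ ∪ A₂) ─ B ∣ ∎
  where
  open ≡-Reasoning
  a₀ = lookup A₀; a₁ = lookup A₁; a₂ = lookup A₂; β = lookup B
  ─≡ : ∀ A → ∣ A ─ B ∣ ≡ count (λ b → lookup A b ∧ not (β b))
  ─≡ A = ∣∣≡count-of (A ─ B) _ (lookup-─ A B)
  pointwise : ∀ x₀ x₁ x₂ y → x₀ ∧ x₁ ≡ false → x₀ ∧ x₂ ≡ false → x₁ ∧ x₂ ≡ false →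
              [ x₀ ∧ not y ] + [ x₁ ∧ not y ] + [ x₂ ∧ not y ] ≡ [ (x₀ ∨ x₁ ∨ x₂) ∧ not y ]
  pointwise x₀    x₁    x₂    true  _  _  _
    rewrite ∧-zeroʳ x₀ | ∧-zeroʳ x₁ | ∧-zeroʳ x₂ | ∧-zeroʳ (x₀ ∨ x₁ ∨ x₂) = refl
  pointwise false false false false _  _  _  = refl
  pointwise true  false false false _  _  _  = refl
  pointwise false true  false false _  _  _  = refl
  pointwise false false true  false _  _  _  = refl
  pointwise true  true  _     false () _  _
  pointwise true  false true  false _  () _
  pointwise false true  true  false _  _  ()

enumerate : (X : Subset n) → Fin ∣ X ∣ → Fin n
enumerate (true  ∷ X) fz     = fz
enumerate (true  ∷ X) (fs c) = fs (enumerate X c)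
enumerate (false ∷ X) c      = fs (enumerate X c)

enumerate-∈ : (X : Subset n) (c : Fin ∣ X ∣) → enumerate X c ∈ X
enumerate-∈ (true  ∷ X) fz     = here
enumerate-∈ (true  ∷ X) (fs c) = there (enumerate-∈ X c)
enumerate-∈ (false ∷ X) c      = there (enumerate-∈ X c)

enumerate-injective : (X : Subset n) → Injective _≡_ _≡_ (enumerate X)
enumerate-injective (true  ∷ X) {fz}   {fz}   _  = refl
enumerate-injective (true  ∷ X) {fs c} {fs d} eq = cong fs (enumerate-injective X (suc-injective eq))
enumerate-injective (false ∷ X)               eq = enumerate-injective X (suc-injective eq)

⋃₃ : (Fin 3 → Subset n) → Subset n
⋃₃ H = H fz ∪ H (fs fz) ∪ H (fs (fs fz))

∈⋃₃⁻ : {A : Fin 3 → Subset n} {a : Fin n} → a ∈ ⋃₃ A → Σ (Fin 3) λ j → a ∈ A j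
∈⋃₃⁻ {A = A} a∈⋃A with x∈p∪q⁻ (A fz) _ a∈⋃A
... | inj₁ a∈A₀ = fz , a∈A₀
... | inj₂ a∈A₁∪A₂ with x∈p∪q⁻ (A (fs fz)) _ a∈A₁∪A₂
...   | inj₁ a∈A₁ = fs fz , a∈A₁
...   | inj₂ a∈A₂ = fs (fs fz) , a∈A₂

∉⋃₃ : {A : Fin 3 → Subset n} {a : Fin n} → a ∉ ⋃₃ A → ∀ j → a ∉ A j
∉⋃₃ a∉⋃A fz           a∈A = a∉⋃A (x∈p∪q⁺ (inj₁ a∈A))
∉⋃₃ a∉⋃A (fs fz)      a∈A = a∉⋃A (x∈p∪q⁺ (inj₂ (x∈p∪q⁺ (inj₁ a∈A))))
∉⋃₃ a∉⋃A (fs (fs fz)) a∈A = a∉⋃A (x∈p∪q⁺ (inj₂ (x∈p∪q⁺ (inj₂ a∈A))))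

-- Degree sums

Symmetric : Graph n → Set
Symmetric {n} X = (a b : Fin n) → X a b ≡ X b a

Loopless : Graph n → Set
Loopless {n} X = (a : Fin n) → X a a ≡ false

degreeSum : Graph n → ℕ
degreeSum {n} X = ∑[ a < n ] count (X a)

deg≡count : (X : Graph n) (a : Fin n) → deg X a ≡ count (X a)
deg≡count {n} X a = trans (listSum-allFin {n} _) (sum-cong-≗ (if-10≡[] ∘ X a))

e≡ : (X : Graph n) → e X ≡ ∑[ a < n ] count (λ b → ⌊ a <? b ⌋ ∧ X a b)
e≡ {n} X = trans (listSum-allFin (λ a → sumL (mapL (edge a) (allFin n))))
                 (sum-cong-≗ {n} λ a → trans (listSum-allFin (edge a)) (sum-cong-≗ {n} (if-10≡[] ∘ before a)))
  where
  before : Fin n → Fin n → Bool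
  before a b = ⌊ a <? b ⌋ ∧ X a b
  edge : Fin n → Fin n → ℕ
  edge a b = if before a b then 1 else 0

module _ {X : Graph n} (X-sym : Symmetric X) where

  private
    diagonal : ℕ
    diagonal = ∑[ a < n ] count (λ b → ⌊ a ≟ b ⌋ ∧ X a b)

    trichotomy : ∀ a b → [ X a b ] ≡ [ ⌊ a <? b ⌋ ∧ X a b ] + [ ⌊ b <? a ⌋ ∧ X b a ] + [ ⌊ a ≟ b ⌋ ∧ X a b ]
    trichotomy a b with <-cmp a b
    ... | tri< a<b a≢b b≮a rewrite ⌊⌋-yes (a <? b) a<b | ⌊⌋-no (b <? a) b≮a | ⌊⌋-no (a ≟ b) a≢b
      = sym (trans (+-identityʳ _) (+-identityʳ _))
    ... | tri≈ a≮a refl _  rewrite ⌊⌋-no (a <? a) a≮a | ⌊≟⌋-refl a = refl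
    ... | tri> a≮b a≢b b<a rewrite ⌊⌋-no (a <? b) a≮b | ⌊⌋-yes (b <? a) b<a | ⌊⌋-no (a ≟ b) a≢b | X-sym a b
      = sym (+-identityʳ _)

    degreeSum≡ : degreeSum X ≡ e X + e X + diagonal
    degreeSum≡ = begin
      degreeSum X
        ≡⟨ sum-cong-≗ (λ a → trans (sum-cong-≗ (trichotomy a)) (sum₃ {n} _ _ _)) ⟩
      ∑[ a < n ] (count (λ b → ⌊ a <? b ⌋ ∧ X a b) + count (λ b → ⌊ b <? a ⌋ ∧ X b a)
                  + count (λ b → ⌊ a ≟ b ⌋ ∧ X a b))
        ≡⟨ sum₃ {n} _ _ _ ⟩
      ∑[ a < n ] count (λ b → ⌊ a <? b ⌋ ∧ X a b) + ∑[ a < n ] count (λ b → ⌊ b <? a ⌋ ∧ X b a) + diagonal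
        ≡⟨ cong₂ (λ s t → s + t + diagonal) (sym (e≡ X)) (trans (∑-comm (λ a b → [ ⌊ b <? a ⌋ ∧ X b a ])) (sym (e≡ X))) ⟩
      e X + e X + diagonal ∎
      where open ≡-Reasoning

  e+e≤degreeSum : e X + e X ≤ degreeSum X
  e+e≤degreeSum = subst (e X + e X ≤_) (sym degreeSum≡) (m≤m+n _ _)

  handshake : Loopless X → degreeSum X ≡ e X + e X
  handshake X-loopless = trans degreeSum≡ (trans (cong (e X + e X +_) diagonal≡0) (+-identityʳ _))
    where
    diagonal≡0 : diagonal ≡ 0
    diagonal≡0 = trans (sum-cong-≗ λ a → trans (sum-cong-≗ (off-diagonal a)) (count-false {n})) (count-false {n})
      where
      off-diagonal : ∀ a b → [ ⌊ a ≟ b ⌋ ∧ X a b ] ≡ [ false ]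
      off-diagonal a b with a ≟ b
      ... | yes refl rewrite X-loopless a = refl
      ... | no  _    = refl

data SplitView {m k : ℕ} : Fin (m + k) → Set where
  left  : (x : Fin m) → SplitView (x ↑ˡ k)
  right : (y : Fin k) → SplitView (m ↑ʳ y)

splitView : (a : Fin (m + k)) → SplitView {m} {k} a
splitView {m} {k} a with splitAt m a in eq
... | inj₁ x = subst SplitView (splitAt⁻¹-↑ˡ eq) (left x)
... | inj₂ y = subst SplitView (splitAt⁻¹-↑ʳ eq) (right y)

↑ˡ≢↑ʳ : (x : Fin m) (y : Fin k) → x ↑ˡ k ≢ m ↑ʳ y
↑ˡ≢↑ʳ {m} {k} x y eq with trans (sym (splitAt-↑ˡ m x k)) (trans (cong (splitAt m) eq) (splitAt-↑ʳ m k y))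
... | ()

module _ (X : Graph m) (Y : Graph k) where

  ⊎G-ll : ∀ x x' → (X ⊎G Y) (x ↑ˡ k) (x' ↑ˡ k) ≡ X x x'
  ⊎G-ll x x' rewrite splitAt-↑ˡ m x k | splitAt-↑ˡ m x' k = refl

  ⊎G-rr : ∀ y y' → (X ⊎G Y) (m ↑ʳ y) (m ↑ʳ y') ≡ Y y y'
  ⊎G-rr y y' rewrite splitAt-↑ʳ m k y | splitAt-↑ʳ m k y' = refl

  ⊎G-lr : ∀ x y → (X ⊎G Y) (x ↑ˡ k) (m ↑ʳ y) ≡ false
  ⊎G-lr x y rewrite splitAt-↑ˡ m x k | splitAt-↑ʳ m k y = refl

  ⊎G-rl : ∀ y x → (X ⊎G Y) (m ↑ʳ y) (x ↑ˡ k) ≡ false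
  ⊎G-rl y x rewrite splitAt-↑ˡ m x k | splitAt-↑ʳ m k y = refl

  ∨G-ll : ∀ x x' → (X ∨G Y) (x ↑ˡ k) (x' ↑ˡ k) ≡ X x x'
  ∨G-ll x x' rewrite splitAt-↑ˡ m x k | splitAt-↑ˡ m x' k = refl

  ∨G-rr : ∀ y y' → (X ∨G Y) (m ↑ʳ y) (m ↑ʳ y') ≡ Y y y'
  ∨G-rr y y' rewrite splitAt-↑ʳ m k y | splitAt-↑ʳ m k y' = refl

  ∨G-lr : ∀ x y → (X ∨G Y) (x ↑ˡ k) (m ↑ʳ y) ≡ true
  ∨G-lr x y rewrite splitAt-↑ˡ m x k | splitAt-↑ʳ m k y | ⌊≟⌋-≢ (↑ˡ≢↑ʳ x y) = refl

  ∨G-rl : ∀ y x → (X ∨G Y) (m ↑ʳ y) (x ↑ˡ k) ≡ true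
  ∨G-rl y x rewrite splitAt-↑ˡ m x k | splitAt-↑ʳ m k y | ⌊≟⌋-≢ (↑ˡ≢↑ʳ x y ∘ sym) = refl

  ⊎G-symmetric : Symmetric X → Symmetric Y → Symmetric (X ⊎G Y)
  ⊎G-symmetric X-sym Y-sym a b with splitView {m} {k} a | splitView {m} {k} b
  ... | left x  | left x'  = trans (⊎G-ll x x') (trans (X-sym x x') (sym (⊎G-ll x' x)))
  ... | left x  | right y  = trans (⊎G-lr x y) (sym (⊎G-rl y x))
  ... | right y | left x   = trans (⊎G-rl y x) (sym (⊎G-lr x y))
  ... | right y | right y' = trans (⊎G-rr y y') (trans (Y-sym y y') (sym (⊎G-rr y' y)))

  ∨G-symmetric : Symmetric X → Symmetric Y → Symmetric (X ∨G Y)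
  ∨G-symmetric X-sym Y-sym a b with splitView {m} {k} a | splitView {m} {k} b
  ... | left x  | left x'  = trans (∨G-ll x x') (trans (X-sym x x') (sym (∨G-ll x' x)))
  ... | left x  | right y  = trans (∨G-lr x y) (sym (∨G-rl y x))
  ... | right y | left x   = trans (∨G-rl y x) (sym (∨G-lr x y))
  ... | right y | right y' = trans (∨G-rr y y') (trans (Y-sym y y') (sym (∨G-rr y' y)))

  ⊎G-loopless : Loopless X → Loopless Y → Loopless (X ⊎G Y)
  ⊎G-loopless X-loopless Y-loopless a with splitView {m} {k} a
  ... | left x  = trans (⊎G-ll x x) (X-loopless x)
  ... | right y = trans (⊎G-rr y y) (Y-loopless y)

  count-↑ : (T : Fin (m + k) → Bool) → count T ≡ count (T ∘ (_↑ˡ k)) + count (T ∘ (m ↑ʳ_))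
  count-↑ T = sum-↑ {m} {k} ([_] ∘ T)

  degreeSum-⊎G : degreeSum (X ⊎G Y) ≡ degreeSum X + degreeSum Y
  degreeSum-⊎G = trans (sum-↑ {m} {k} _) (cong₂ _+_ (sum-cong-≗ {m} left-degree) (sum-cong-≗ {k} right-degree))
    where
    left-degree : ∀ x → count ((X ⊎G Y) (x ↑ˡ k)) ≡ count (X x)
    left-degree x = trans (count-↑ _) (trans (cong₂ _+_ (sum-cong-≗ {m} (cong [_] ∘ ⊎G-ll x))
                                                        (trans (sum-cong-≗ {k} (cong [_] ∘ ⊎G-lr x)) (count-false {k})))
                                             (+-identityʳ _))
    right-degree : ∀ y → count ((X ⊎G Y) (m ↑ʳ y)) ≡ count (Y y)
    right-degree y = trans (count-↑ _) (cong₂ _+_ (trans (sum-cong-≗ {m} (cong [_] ∘ ⊎G-rl y)) (count-false {m}))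
                                                  (sum-cong-≗ {k} (cong [_] ∘ ⊎G-rr y)))

  degreeSum-∨G : degreeSum (X ∨G Y) ≡ degreeSum X + m * k + (k * m + degreeSum Y)
  degreeSum-∨G = begin
    degreeSum (X ∨G Y)
      ≡⟨ sum-↑ {m} {k} _ ⟩
    ∑[ x < m ] count ((X ∨G Y) (x ↑ˡ k)) + ∑[ y < k ] count ((X ∨G Y) (m ↑ʳ y))
      ≡⟨ cong₂ _+_ (sum-cong-≗ {m} left-degree) (sum-cong-≗ {k} right-degree) ⟩
    ∑[ x < m ] (count (X x) + k) + ∑[ y < k ] (m + count (Y y))
      ≡⟨ cong₂ _+_ (trans (∑-distrib-+ {m} _ _) (cong (degreeSum X +_) (sum-const m k)))
                   (trans (∑-distrib-+ {k} _ _) (cong (_+ degreeSum Y) (sum-const k m))) ⟩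
    degreeSum X + m * k + (k * m + degreeSum Y) ∎
    where
    open ≡-Reasoning
    left-degree : ∀ x → count ((X ∨G Y) (x ↑ˡ k)) ≡ count (X x) + k
    left-degree x = trans (count-↑ _) (cong₂ _+_ (sum-cong-≗ {m} (cong [_] ∘ ∨G-ll x))
                                                 (trans (sum-cong-≗ {k} (cong [_] ∘ ∨G-lr x)) (count-true {k})))
    right-degree : ∀ y → count ((X ∨G Y) (m ↑ʳ y)) ≡ m + count (Y y)
    right-degree y = trans (count-↑ _) (cong₂ _+_ (trans (sum-cong-≗ {m} (cong [_] ∘ ∨G-rl y)) (count-true {m}))
                                                  (sum-cong-≗ {k} (cong [_] ∘ ∨G-rr y)))

K-symmetric : Symmetric (K m)
K-symmetric a b = cong not (⌊≟⌋-sym a b)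

K-loopless : Loopless (K m)
K-loopless a = cong not (⌊≟⌋-refl a)

I-symmetric : Symmetric (I m)
I-symmetric a b = refl

degreeSum-K : ∀ m → degreeSum (K m) ≡ m * (m ∸ 1)
degreeSum-K m = trans (sum-cong-≗ {m} degree) (sum-const m (m ∸ 1))
  where
  degree+1 : ∀ a → count (K m a) + 1 ≡ m
  degree+1 a = begin
    count (K m a) + 1                             ≡⟨ cong (count (K m a) +_) (count-singleton a) ⟨
    count (K m a) + count (λ b → ⌊ a ≟ b ⌋)       ≡⟨ ∑-distrib-+ {m} _ _ ⟨
    ∑[ b < m ] ([ not ⌊ a ≟ b ⌋ ] + [ ⌊ a ≟ b ⌋ ]) ≡⟨ sum-cong-≗ {m} (λ b → not+id ⌊ a ≟ b ⌋) ⟩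
    count {m} (λ _ → true)                        ≡⟨ count-true ⟩
    m                                             ∎
    where
    open ≡-Reasoning
    not+id : ∀ x → [ not x ] + [ x ] ≡ 1
    not+id true  = refl
    not+id false = refl
  degree : ∀ a → count (K m a) ≡ m ∸ 1
  degree a = trans (sym (m+n∸n≡m _ 1)) (cong (_∸ 1) (degree+1 a))

degreeSum-I : ∀ m → degreeSum (I m) ≡ 0
degreeSum-I m = trans (sum-cong-≗ {m} (λ _ → count-false {m})) (count-false {m})

-- Common cliques, embeddings and saturation

false≢true : false ≢ true
false≢true ()

record CommonClique (G : Graph n) (t : ℕ) (a b : Fin n) : Set where
  field
    vertex    : Fin t → Fin n
    injective : Injective _≡_ _≡_ vertex
    adjacentˡ : ∀ c → G a (vertex c) ≡ true
    adjacentʳ : ∀ c → G b (vertex c) ≡ true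
    clique    : ∀ c c' → c ≢ c' → G (vertex c) (vertex c') ≡ true

EdgesInCommonCliques : Graph n → ℕ → Set
EdgesInCommonCliques {n} X t = (a b : Fin n) → X a b ≡ true → CommonClique X t a b

K-true⇒≢ : {a b : Fin m} → K m a b ≡ true → a ≢ b
K-true⇒≢ {m} {a = a} Kab refl = false≢true (trans (sym (K-loopless {m} a)) Kab)

≢⇒K-true : {a b : Fin m} → a ≢ b → K m a b ≡ true
≢⇒K-true a≢b = cong not (⌊≟⌋-≢ a≢b)

K-edges : ∀ m → EdgesInCommonCliques (K m) (m ∸ 2)
K-edges (suc zero)     fz fz ()
K-edges (suc (suc m')) a  b  Kab = record
  { vertex    = vertex
  ; injective = punchIn-injective b' _ _ ∘ punchIn-injective a _ _
  ; adjacentˡ = λ c → ≢⇒K-true (punchInᵢ≢i a _ ∘ sym)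
  ; adjacentʳ = λ c → ≢⇒K-true λ b≡v → punchInᵢ≢i b' c
                   (punchIn-injective a _ _ (trans (sym b≡v) (sym (punchIn-punchOut a≢b))))
  ; clique    = λ c c' c≢c' → ≢⇒K-true (c≢c' ∘ punchIn-injective b' _ _ ∘ punchIn-injective a _ _)
  }
  where
  a≢b = K-true⇒≢ Kab
  b'  = punchOut a≢b
  vertex : Fin m' → Fin (suc (suc m'))
  vertex c = punchIn a (punchIn b' c)

commonClique-≤ : {X : Graph n} {a b : Fin n} {t t' : ℕ} → t' ≤ t → CommonClique X t a b → CommonClique X t' a b
commonClique-≤ t'≤t C = record
  { vertex    = vertex ∘ inj
  ; injective = inject≤-injective t'≤t t'≤t _ _ ∘ injective
  ; adjacentˡ = adjacentˡ ∘ inj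
  ; adjacentʳ = adjacentʳ ∘ inj
  ; clique    = λ c c' c≢c' → clique (inj c) (inj c') (c≢c' ∘ inject≤-injective t'≤t t'≤t _ _)
  }
  where
  open CommonClique C
  inj = λ c → inject≤ c t'≤t

module _ {X : Graph m} {Y : Graph k} {t : ℕ} where

  ⊎G-edges : EdgesInCommonCliques X t → EdgesInCommonCliques Y t → EdgesInCommonCliques (X ⊎G Y) t
  ⊎G-edges X-edges Y-edges a b XYab with splitView {m} {k} a | splitView {m} {k} b
  ... | left x  | left x'  = let open CommonClique (X-edges x x' (trans (sym (⊎G-ll X Y x x')) XYab)) in record
    { vertex    = (_↑ˡ k) ∘ vertex
    ; injective = injective ∘ ↑ˡ-injective k _ _
    ; adjacentˡ = λ c → trans (⊎G-ll X Y _ _) (adjacentˡ c)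
    ; adjacentʳ = λ c → trans (⊎G-ll X Y _ _) (adjacentʳ c)
    ; clique    = λ c c' c≢c' → trans (⊎G-ll X Y _ _) (clique c c' c≢c')
    }
  ... | right y | right y' = let open CommonClique (Y-edges y y' (trans (sym (⊎G-rr X Y y y')) XYab)) in record
    { vertex    = (m ↑ʳ_) ∘ vertex
    ; injective = injective ∘ ↑ʳ-injective m _ _
    ; adjacentˡ = λ c → trans (⊎G-rr X Y _ _) (adjacentˡ c)
    ; adjacentʳ = λ c → trans (⊎G-rr X Y _ _) (adjacentʳ c)
    ; clique    = λ c c' c≢c' → trans (⊎G-rr X Y _ _) (clique c c' c≢c')
    }
  ... | left x  | right y  = contradiction (trans (sym (⊎G-lr X Y x y)) XYab) false≢true
  ... | right y | left x   = contradiction (trans (sym (⊎G-rl X Y y x)) XYab) false≢true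

F4-edges : ∀ {p1 p2 p3 p4} → p1 ≤ p2 → p2 ≤ p3 → p3 ≤ p4 → EdgesInCommonCliques (F4 p1 p2 p3 p4) (p1 ∸ 2)
F4-edges {p1} {p2} {p3} {p4} p1≤p2 p2≤p3 p3≤p4 =
  ⊎G-edges (K-edges p1) (⊎G-edges (shrink p1≤p2 (K-edges p2))
                          (⊎G-edges (shrink p1≤p3 (K-edges p3)) (shrink p1≤p4 (K-edges p4))))
  where
  p1≤p3 = ≤-trans p1≤p2 p2≤p3
  p1≤p4 = ≤-trans p1≤p3 p3≤p4
  shrink : ∀ {p q} → p ≤ q → EdgesInCommonCliques (K q) (q ∸ 2) → EdgesInCommonCliques (K q) (p ∸ 2)
  shrink p≤q edges a b Kab = commonClique-≤ (∸-monoˡ-≤ 2 p≤q) (edges a b Kab)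

F4-symmetric : ∀ p1 p2 p3 p4 → Symmetric (F4 p1 p2 p3 p4)
F4-symmetric p1 p2 p3 p4 =
  ⊎G-symmetric (K p1) _ K-symmetric (⊎G-symmetric (K p2) _ K-symmetric
    (⊎G-symmetric (K p3) (K p4) K-symmetric K-symmetric))

F4-loopless : ∀ p1 p2 p3 p4 → Loopless (F4 p1 p2 p3 p4)
F4-loopless p1 p2 p3 p4 =
  ⊎G-loopless (K p1) _ (K-loopless {p1}) (⊎G-loopless (K p2) _ (K-loopless {p2})
    (⊎G-loopless (K p3) (K p4) (K-loopless {p3}) (K-loopless {p4})))

record ContainsWithin {m n : ℕ} (F : Graph m) (G : Graph n) (T : Fin n → Set) : Set where
  field
    embedding : Fin m → Fin n
    injective : Injective _≡_ _≡_ embedding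
    edges     : (a b : Fin m) → F a b ≡ true → G (embedding a) (embedding b) ≡ true
    within    : ∀ a → T (embedding a)

  contains : Contains F G
  contains = embedding , injective , edges

IsCliqueMap : Graph n → (Fin k → Fin n) → Set
IsCliqueMap G h = Injective _≡_ _≡_ h × (∀ c c' → c ≢ c' → G (h c) (h c') ≡ true)

cliqueMap-containsWithin : (G : Graph n) {T : Fin n → Set} {h : Fin m → Fin n} → IsCliqueMap G h → (∀ c → T (h c)) →
                           ContainsWithin (K m) G T
cliqueMap-containsWithin G {h = h} (h-inj , h-clique) h∈T = record
  { embedding = h ; injective = h-inj ; edges = λ a b Kab → h-clique a b (K-true⇒≢ Kab) ; within = h∈T }

⊎G-containsWithin : {X : Graph m} {Y : Graph k} {G : Graph n} {T U : Fin n → Set} →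
                    ContainsWithin X G T → ContainsWithin Y G U → (∀ z → T z → U z → ⊥) →
                    ContainsWithin (X ⊎G Y) G (λ z → T z ⊎ U z)
⊎G-containsWithin {m} {k} {X = X} {Y} {G} {T} {U} CX CY T∩U=∅ = record
  { embedding = h ; injective = h-inj ; edges = h-edge ; within = h∈T∪U }
  where
  open ContainsWithin CX renaming (embedding to f; injective to f-inj; edges to f-edge; within to f∈T)
  open ContainsWithin CY renaming (embedding to g; injective to g-inj; edges to g-edge; within to g∈U)
  h : Fin (m + k) → Fin _
  h a with splitAt m a
  ... | inj₁ x = f x
  ... | inj₂ y = g y
  h-l : ∀ x → h (x ↑ˡ k) ≡ f x
  h-l x rewrite splitAt-↑ˡ m x k = refl
  h-r : ∀ y → h (m ↑ʳ y) ≡ g y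
  h-r y rewrite splitAt-↑ʳ m k y = refl
  apart : ∀ x y → f x ≢ g y
  apart x y fx≡gy = T∩U=∅ (f x) (f∈T x) (subst U (sym fx≡gy) (g∈U y))
  h-inj : Injective _≡_ _≡_ h
  h-inj {a} {b} ha≡hb with splitView {m} {k} a | splitView {m} {k} b
  ... | left x  | left x'  = cong (_↑ˡ k) (f-inj (trans (sym (h-l x)) (trans ha≡hb (h-l x'))))
  ... | right y | right y' = cong (m ↑ʳ_) (g-inj (trans (sym (h-r y)) (trans ha≡hb (h-r y'))))
  ... | left x  | right y  = contradiction (trans (sym (h-l x)) (trans ha≡hb (h-r y))) (apart x y)
  ... | right y | left x   = contradiction (trans (sym (h-l x)) (trans (sym ha≡hb) (h-r y))) (apart x y)
  h-edge : ∀ a b → (X ⊎G Y) a b ≡ true → G (h a) (h b) ≡ true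
  h-edge a b XYab with splitView {m} {k} a | splitView {m} {k} b
  ... | left x  | left x'  rewrite h-l x | h-l x' = f-edge x x' (trans (sym (⊎G-ll X Y x x')) XYab)
  ... | right y | right y' rewrite h-r y | h-r y' = g-edge y y' (trans (sym (⊎G-rr X Y y y')) XYab)
  ... | left x  | right y  = contradiction (trans (sym (⊎G-lr X Y x y)) XYab) false≢true
  ... | right y | left x   = contradiction (trans (sym (⊎G-rl X Y y x)) XYab) false≢true
  h∈T∪U : ∀ a → T (h a) ⊎ U (h a)
  h∈T∪U a with splitView {m} {k} a
  ... | left x  rewrite h-l x = inj₁ (f∈T x)
  ... | right y rewrite h-r y = inj₂ (g∈U y)

addEdge-old : (G : Graph n) {u v x y : Fin n} → addEdge G u v x y ≡ true →
              ¬ (x ≡ u × y ≡ v) → ¬ (x ≡ v × y ≡ u) → G x y ≡ true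
addEdge-old G {u} {v} {x} {y} new uv≢xy vu≢xy with G x y | x ≟ u | y ≟ v | x ≟ v | y ≟ u
... | true  | _       | _       | _       | _       = refl
... | false | yes x≡u | yes y≡v | _       | _       = contradiction (x≡u , y≡v) uv≢xy
... | false | _       | _       | yes x≡v | yes y≡u = contradiction (x≡v , y≡u) vu≢xy
... | false | no _    | _       | no _    | _       = contradiction new false≢true
... | false | no _    | _       | yes _   | no _    = contradiction new false≢true
... | false | yes _   | no _    | no _    | _       = contradiction new false≢true
... | false | yes _   | no _    | yes _   | no _    = contradiction new false≢true

module _ {F : Graph m} {G : Graph n} {t : ℕ} (F-sym : Symmetric F) (F-loopless : Loopless F)
         (F-edges : EdgesInCommonCliques F t) (sat : Saturated F G) where

  -- Some edge ab of F must land on the new edge uv; the common clique of ab in F lands on a common clique of uv in G.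
  saturated⇒commonClique : {u v : Fin n} → u ≢ v → G u v ≡ false → CommonClique G t u v
  saturated⇒commonClique {u} {v} u≢v Guv≡false with proj₂ sat u v u≢v Guv≡false
  ... | f , f-inj , f-edge with any? (λ a → any? (λ b → (F a b Bool.≟ true) ×-dec ((f a ≟ u) ×-dec (f b ≟ v))))
  ... | no none = contradiction (f , (λ {x y} → f-inj {x} {y}) , G-edge) (proj₁ sat)
    where
    G-edge : ∀ a b → F a b ≡ true → G (f a) (f b) ≡ true
    G-edge a b Fab = addEdge-old G (f-edge a b Fab)
      (λ (fa≡u , fb≡v) → none (a , b , Fab , fa≡u , fb≡v))
      (λ (fa≡v , fb≡u) → none (b , a , trans (F-sym b a) Fab , fb≡u , fa≡v))
  ... | yes (a , b , Fab , fa≡u , fb≡v) = record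
    { vertex    = f ∘ vertex
    ; injective = injective ∘ f-inj
    ; adjacentˡ = λ c → subst (λ z → G z (f (vertex c)) ≡ true) fa≡u (old c (f-edge a (vertex c) (adjacentˡ c)))
    ; adjacentʳ = λ c → subst (λ z → G z (f (vertex c)) ≡ true) fb≡v (old c (f-edge b (vertex c) (adjacentʳ c)))
    ; clique    = λ c c' c≢c' → old c' (f-edge (vertex c) (vertex c') (clique c c' c≢c'))
    }
    where
    open CommonClique (F-edges a b Fab)
    fvertex≢u : ∀ c → f (vertex c) ≢ u
    fvertex≢u c fc≡u = false≢true (trans (sym (F-loopless a))
      (subst (λ z → F a z ≡ true) (f-inj (trans fc≡u (sym fa≡u))) (adjacentˡ c)))
    fvertex≢v : ∀ c → f (vertex c) ≢ v
    fvertex≢v c fc≡v = false≢true (trans (sym (F-loopless b))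
      (subst (λ z → F b z ≡ true) (f-inj (trans fc≡v (sym fb≡v))) (adjacentʳ c)))
    old : ∀ {x} c → addEdge G u v x (f (vertex c)) ≡ true → G x (f (vertex c)) ≡ true
    old c new = addEdge-old G new (fvertex≢v c ∘ proj₂) (fvertex≢u c ∘ proj₂)

module _ {G : Graph n} (G-sym : Symmetric G) (G-loopless : Loopless G) where

  adjacent⇒≢ : ∀ {a b} → G a b ≡ true → a ≢ b
  adjacent⇒≢ {a} Gab refl = false≢true (trans (sym (G-loopless a)) Gab)

  cliqueMap-∷ : (x : Fin n) {h : Fin k → Fin n} → IsCliqueMap G h → (∀ c → G x (h c) ≡ true) →
                IsCliqueMap G (x Vector.∷ h)
  cliqueMap-∷ x {h} (h-inj , h-clique) x~h = inj , clique
    where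
    inj : Injective _≡_ _≡_ (x Vector.∷ h)
    inj {fz}   {fz}   _  = refl
    inj {fz}   {fs c} eq = contradiction eq (adjacent⇒≢ (x~h c))
    inj {fs c} {fz}   eq = contradiction (sym eq) (adjacent⇒≢ (x~h c))
    inj {fs c} {fs d} eq = cong fs (h-inj eq)
    clique : ∀ c c' → c ≢ c' → G ((x Vector.∷ h) c) ((x Vector.∷ h) c') ≡ true
    clique fz     fz      0≢0   = contradiction refl 0≢0
    clique fz     (fs c') _     = x~h c'
    clique (fs c) fz      _     = trans (G-sym (h c) x) (x~h c)
    clique (fs c) (fs c') c≢c' = h-clique c c' (c≢c' ∘ cong fs)

subset-containsWithin : (G : Graph n) (X : Subset n) → IsClique G X → ContainsWithin (K ∣ X ∣) G (_∈ X)
subset-containsWithin G X X-clique = cliqueMap-containsWithin G {T = _∈ X}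
  (enumerate-injective X , λ c c' c≢c' → X-clique _ _ (enumerate-∈ X c) (enumerate-∈ X c') (c≢c' ∘ enumerate-injective X))
  (enumerate-∈ X)

cliqueMap-degree : (G : Graph n) (T : Fin n → Bool) {h : Fin k → Fin n} → IsCliqueMap G h → (∀ c → T (h c) ≡ true) →
                   ∀ c → k ∸ 1 ≤ count (λ b → G (h c) b ∧ T b)
cliqueMap-degree {k = suc k} G T {h} (h-inj , h-clique) h∈T c =
  count-injection _ (h ∘ punchIn c) (punchIn-injective c _ _ ∘ h-inj) λ d →
    trans (cong₂ _∧_ (h-clique c (punchIn c d) (punchInᵢ≢i c d ∘ sym)) (h∈T (punchIn c d))) refl

-- Arithmetic of the degree-sum bounds

-- upperBound P M Dq is the degree sum of H = K_P ∨ Y, where Y has M vertices and degree sum Dq.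
-- lowerBound P δ r bounds the degree sum of G when v has degree δ and r non-neighbours: the edges
-- ending in S = N(v) give δ + rP + P(P - 1), those ending in the r + 1 vertices outside S at least δ each.
lowerBound : ℕ → ℕ → ℕ → ℕ
lowerBound P δ r = δ + r * P + P * (P ∸ 1) + suc r * δ

upperBound : ℕ → ℕ → ℕ → ℕ
upperBound P M Dq = P * (P ∸ 1) + P * M + (M * P + Dq)

upperBound<large : ∀ P n M Dq → M + P ≡ n → Dq < n → upperBound P M Dq < n * suc (P + P)
upperBound<large P n M Dq M+P≡n Dq<n = begin-strict
  P * (P ∸ 1) + P * M + (M * P + Dq)        ≤⟨ +-mono-≤ (+-monoˡ-≤ (P * M) (*-monoʳ-≤ P (m∸n≤m P 1))) ≤-refl ⟩
  P * P + P * M + (M * P + Dq)              <⟨ +-monoʳ-< (P * P + P * M) (+-monoʳ-< (M * P) Dq<n) ⟩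
  P * P + P * M + (M * P + n)               ≤⟨ m≤m+n _ (P * P) ⟩
  P * P + P * M + (M * P + n) + P * P       ≡⟨ cong (λ k → P * P + P * M + (M * P + k) + P * P) (sym M+P≡n) ⟩
  P * P + P * M + (M * P + (M + P)) + P * P ≡⟨ identity P M ⟩
  (M + P) * suc (P + P)                     ≡⟨ cong (_* suc (P + P)) M+P≡n ⟩
  n * suc (P + P)                           ∎
  where
  open ≤-Reasoning
  identity : ∀ P M → P * P + P * M + (M * P + (M + P)) + P * P ≡ (M + P) * suc (P + P)
  identity = solve-∀

room⇒r-large : ∀ P' t r D' → 3 * suc P' + (t + D') < suc (suc (suc P') + t + r) → suc (P' + P' + D') ≤ r
room⇒r-large P' t r D' room = ≤-pred (+-cancelˡ-≤ (suc P' + t) _ _ (subst₂ _≤_ (room-lhs P' t D') (room-rhs P' t r) (≤-pred room)))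
  where
  room-lhs : ∀ P' t D' → 3 * suc P' + (t + D') ≡ suc P' + t + suc (suc (P' + P' + D'))
  room-lhs = solve-∀
  room-rhs : ∀ P' t r → suc (suc P') + t + r ≡ suc P' + t + suc r
  room-rhs = solve-∀

M+P≡n⇒M≡ : ∀ P' t r M → M + suc P' ≡ suc (suc (suc P') + t + r) → M ≡ 2 + t + r
M+P≡n⇒M≡ P' t r M M+P≡n = +-cancelʳ-≡ (suc P') M (2 + t + r) (trans M+P≡n (regroup P' t r))
  where
  regroup : ∀ P' t r → suc (suc (suc P') + t + r) ≡ 2 + t + r + suc P'
  regroup = solve-∀

-- δ, Dq and r written as P + 1 + t, t + D' and 2P - 1 + D' + s; the identity is stated unfolded for solve-∀.
lowerBound-excess : ∀ P' t D' s →
  lowerBound (suc P') (suc (suc P') + t) (suc (P' + P' + D') + s) ≡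
  suc (upperBound (suc P') (2 + t + (suc (P' + P' + D') + s)) (t + D') + (D' * t + s * suc t))
lowerBound-excess P' t D' s = expanded P' t D' s
  where
  expanded : ∀ P' t D' s →
    (suc (suc P') + t) + (suc (P' + P' + D') + s) * suc P' + suc P' * P' + suc (suc (P' + P' + D') + s) * (suc (suc P') + t) ≡
    suc (suc P' * P' + suc P' * (2 + t + (suc (P' + P' + D') + s)) + ((2 + t + (suc (P' + P' + D') + s)) * suc P' + (t + D')) + (D' * t + s * suc t))
  expanded = solve-∀

upperBound<moderate : ∀ P t r M Dq → M + P ≡ suc (suc P + t + r) → 3 * P + Dq < suc (suc P + t + r) →
                      P ≤ Dq → t < P → upperBound P M Dq < lowerBound P (suc P + t) r
upperBound<moderate (suc P') t r M Dq M+P≡n room P≤Dq (s≤s t≤P')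
  with D' , refl ← m≤n⇒∃[o]m+o≡n (≤-trans t≤P' (≤-trans (n≤1+n P') P≤Dq))
  with s  , refl ← m≤n⇒∃[o]m+o≡n (room⇒r-large P' t r D' room)
  rewrite M+P≡n⇒M≡ P' t r M M+P≡n =
  subst (upperBound (suc P') (2 + t + r) (t + D') <_) (sym (lowerBound-excess P' t D' s)) (s≤s (m≤m+n _ _))

bounds⇒δ≤P : ∀ P δ r M Dq → M + P ≡ suc (δ + r) → 3 * P + Dq < suc (δ + r) → P ≤ Dq →
      lowerBound P δ r ≤ upperBound P M Dq → suc (δ + r) * δ ≤ upperBound P M Dq → δ ≤ P
bounds⇒δ≤P P δ r M Dq M+P≡n room P≤Dq lower≤upper nδ≤upper with δ ≤? P
... | yes δ≤P = δ≤P
... | no  δ≰P with t , refl ← m≤n⇒∃[o]m+o≡n (≰⇒> δ≰P) with suc t ≤? P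
...   | yes t<P = contradiction lower≤upper (<⇒≱ (upperBound<moderate P t r M Dq M+P≡n room P≤Dq t<P))
...   | no  t≮P = contradiction nδ≤upper (<⇒≱ (begin-strict
        upperBound P M Dq          <⟨ upperBound<large P _ M Dq M+P≡n (≤-trans (s≤s (m≤n+m Dq (3 * P))) room) ⟩
        suc (δ + r) * suc (P + P)  ≤⟨ *-monoʳ-≤ (suc (δ + r)) (s≤s (+-monoʳ-≤ P (≮⇒≥ t≮P))) ⟩
        suc (δ + r) * δ            ∎))
  where open ≤-Reasoning

p+p≤p*[p+1] : ∀ p → p + p ≤ p * (p + 1)
p+p≤p*[p+1] zero    = z≤n
p+p≤p*[p+1] (suc p) = subst (suc p + suc p ≤_) (square (suc p)) (+-monoˡ-≤ (suc p) (m≤m*n (suc p) (suc p)))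
  where
  square : ∀ p → p * p + p ≡ p * (p + 1)
  square = solve-∀

p≤p*[p+1] : ∀ p → p ≤ p * (p + 1)
p≤p*[p+1] p = ≤-trans (m≤m+n p p) (p+p≤p*[p+1] p)

sum≤Dq : ∀ p1 p2 p3 p4 → p1 ≤ p2 → p1 + p2 + p3 + p4 ≤ p2 * (p2 + 1) + p3 * (p3 + 1) + p4 * (p4 + 1)
sum≤Dq p1 p2 p3 p4 p1≤p2 =
  +-mono-≤ (+-mono-≤ (≤-trans (+-monoˡ-≤ p2 p1≤p2) (p+p≤p*[p+1] p2)) (p≤p*[p+1] p3)) (p≤p*[p+1] p4)

Hgraph-size : ∀ p1 p2 p3 p4 n → 2 ≤ p1 → p1 + p2 + p3 + p4 < n →
  p2 + 1 + (p3 + 1 + (p4 + 1 + (n + 3 ∸ 4 ∸ (p1 + p2 + p3 + p4)))) + (p1 ∸ 2) ≡ n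
Hgraph-size (suc (suc P)) p2 p3 p4 n (s≤s (s≤s _)) Σp<n with k , refl ← m≤n⇒∃[o]m+o≡n Σp<n = begin
  p2 + 1 + (p3 + 1 + (p4 + 1 + (Σp + k + 3 ∸ 3 ∸ Σp))) + P
    ≡⟨ cong (λ z → p2 + 1 + (p3 + 1 + (p4 + 1 + (z ∸ Σp))) + P) (m+n∸n≡m (Σp + k) 3) ⟩
  p2 + 1 + (p3 + 1 + (p4 + 1 + (Σp + k ∸ Σp))) + P
    ≡⟨ cong (λ z → p2 + 1 + (p3 + 1 + (p4 + 1 + z)) + P) (m+n∸m≡n Σp k) ⟩
  p2 + 1 + (p3 + 1 + (p4 + 1 + k)) + P
    ≡⟨ regroup P p2 p3 p4 k ⟩
  suc (Σp + k) ∎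
  where
  open ≡-Reasoning
  Σp = suc (suc P) + p2 + p3 + p4
  regroup : ∀ P p2 p3 p4 k → p2 + 1 + (p3 + 1 + (p4 + 1 + k)) + P ≡ suc (suc (suc P) + p2 + p3 + p4 + k)
  regroup = solve-∀

a+d≡q⇒a≡q∸d : ∀ {a d q} → a + d ≡ q → a ≡ q ∸ d
a+d≡q⇒a≡q∸d {a} {d} refl = sym (m+n∸n≡m a d)

deficit≤1⇒bounds : ∀ {a d q} → a + d ≡ q → d ≤ 1 → q ∸ 1 ≤ a × a ≤ q
deficit≤1⇒bounds {a} {d} refl d≤1 = ≤-trans (∸-monoˡ-≤ 1 (+-monoʳ-≤ a d≤1)) (≤-reflexive (m+n∸n≡m a 1)) , m≤m+n a d

∑₃ : (Fin 3 → ℕ) → ℕ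
∑₃ f = f fz + f (fs fz) + f (fs (fs fz))

pair≤∑₃ : (f : Fin 3 → ℕ) {i k : Fin 3} → i ≢ k → f i + f k ≤ ∑₃ f
pair≤∑₃ f {fz}         {fz}         0≢0 = contradiction refl 0≢0
pair≤∑₃ f {fs fz}      {fs fz}      1≢1 = contradiction refl 1≢1
pair≤∑₃ f {fs (fs fz)} {fs (fs fz)} 2≢2 = contradiction refl 2≢2
pair≤∑₃ f {fz}         {fs fz}      _   = m≤m+n (f fz + f (fs fz)) (f (fs (fs fz)))
pair≤∑₃ f {fz}         {fs (fs fz)} _   = +-monoˡ-≤ (f (fs (fs fz))) (m≤m+n (f fz) (f (fs fz)))
pair≤∑₃ f {fs fz}      {fs (fs fz)} _   = +-monoˡ-≤ (f (fs (fs fz))) (m≤n+m (f (fs fz)) (f fz))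
pair≤∑₃ f {fs fz}      {fz}         _   =
  subst (_≤ ∑₃ f) (+-comm (f fz) (f (fs fz))) (pair≤∑₃ f {fz} {fs fz} λ ())
pair≤∑₃ f {fs (fs fz)} {fz}         _   =
  subst (_≤ ∑₃ f) (+-comm (f fz) (f (fs (fs fz)))) (pair≤∑₃ f {fz} {fs (fs fz)} λ ())
pair≤∑₃ f {fs (fs fz)} {fs fz}      _   =
  subst (_≤ ∑₃ f) (+-comm (f (fs fz)) (f (fs (fs fz)))) (pair≤∑₃ f {fs fz} {fs (fs fz)} λ ())

∑₃≡1⇒others≡0 : (f : Fin 3 → ℕ) {i k : Fin 3} → ∑₃ f ≡ 1 → f i ≡ 1 → k ≢ i → f k ≡ 0
∑₃≡1⇒others≡0 f {i} {k} ∑f≡1 fᵢ≡1 k≢i =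
  n≤0⇒n≡0 (+-cancelˡ-≤ 1 (f k) 0 (subst₂ (λ a b → a + f k ≤ b) fᵢ≡1 ∑f≡1 (pair≤∑₃ f (k≢i ∘ sym))))

-- The saturated graph G

module Setting
  (p1 p2 p3 p4 n : ℕ) (2≤p1 : 2 ≤ p1) (p1≤p2 : p1 ≤ p2) (p2≤p3 : p2 ≤ p3) (p3≤p4 : p3 ≤ p4)
  (n-large : 3 * (p1 ∸ 2) + (p2 * (p2 + 1) + p3 * (p3 + 1) + p4 * (p4 + 1)) < n)
  (G : Graph n) (G-simple : IsSimple G) (G-saturated : Saturated (F4 p1 p2 p3 p4) G)
  (e-G≤e-H : e G ≤ e (Hgraph n p1 p2 p3 p4))
  (v : Fin n) (v-minimum : (u : Fin n) → deg G v ≤ deg G u)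
  (w : Fin n) (w∉S : w ∉ N G v) (w≢v : w ≢ v) where

  P : ℕ
  P = p1 ∸ 2

  Dq : ℕ
  Dq = p2 * (p2 + 1) + p3 * (p3 + 1) + p4 * (p4 + 1)

  G-sym : Symmetric G
  G-sym = proj₁ G-simple

  G-loopless : Loopless G
  G-loopless = proj₂ G-simple

  S : Fin n → Bool
  S = G v

  δ : ℕ
  δ = count S

  ∉N⇒S-false : ∀ {b} → b ∉ N G v → S b ≡ false
  ∉N⇒S-false {b} b∉N = trans (sym (lookup∘tabulate (G v) b)) (∉⇒lookup b∉N)

  commonClique : ∀ {u} → u ≢ v → S u ≡ false → CommonClique G P v u
  commonClique u≢v = saturated⇒commonClique (F4-symmetric p1 p2 p3 p4) (F4-loopless p1 p2 p3 p4)
                       (F4-edges p1≤p2 p2≤p3 p3≤p4) G-saturated (u≢v ∘ sym)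

  module Q = CommonClique (commonClique w≢v (∉N⇒S-false w∉S))

  inQ : Fin n → Bool
  inQ a = ⌊ any? (λ c → Q.vertex c ≟ a) ⌋

  inQ⇒vertex : ∀ {a} → inQ a ≡ true → Σ (Fin P) λ c → Q.vertex c ≡ a
  inQ⇒vertex {a} Qa with any? (λ c → Q.vertex c ≟ a)
  ... | yes hit = hit

  S-false⇒inQ-false : ∀ {a} → S a ≡ false → inQ a ≡ false
  S-false⇒inQ-false {a} Sa with inQ a in Qa
  ... | false = refl
  ... | true  with c , refl ← inQ⇒vertex Qa = contradiction (trans (sym (Q.adjacentˡ c)) Sa) λ ()

  nonNeighbour : Fin n → Bool
  nonNeighbour b = not ⌊ v ≟ b ⌋ ∧ not (S b)

  r : ℕ
  r = count nonNeighbour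

  count-not-S : count (not ∘ S) ≡ suc r
  count-not-S = trans (sum-cong-≗ {n} pointwise) (trans (∑-distrib-+ {n} _ _) (cong (_+ r) (count-singleton v)))
    where
    pointwise : ∀ b → [ not (S b) ] ≡ [ ⌊ v ≟ b ⌋ ] + [ nonNeighbour b ]
    pointwise b with v ≟ b
    ... | yes refl rewrite G-loopless v = refl
    ... | no  _    = refl

  n≡1+δ+r : n ≡ suc (δ + r)
  n≡1+δ+r = begin
    n                                  ≡⟨ count-true ⟨
    count {n} (λ _ → true)             ≡⟨ sum-cong-≗ {n} (λ b → split (S b)) ⟩
    ∑[ b < n ] ([ S b ] + [ not (S b) ]) ≡⟨ ∑-distrib-+ {n} _ _ ⟩
    δ + count (not ∘ S)                ≡⟨ cong (δ +_) count-not-S ⟩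
    δ + suc r                          ≡⟨ +-suc δ r ⟩
    suc (δ + r)                        ∎
    where
    open ≡-Reasoning
    split : ∀ x → [ true ] ≡ [ x ] + [ not x ]
    split true  = refl
    split false = refl

  P≤count-inQ : P ≤ count inQ
  P≤count-inQ = count-injection inQ Q.vertex Q.injective λ c → ⌊⌋-yes (any? (λ c' → Q.vertex c' ≟ Q.vertex c)) (c , refl)

  -- v sees all of S, a non-neighbour sees its P common neighbours with v, a vertex of Q the rest of Q.
  S-degree : ∀ a → [ ⌊ v ≟ a ⌋ ] * δ + [ not ⌊ v ≟ a ⌋ ∧ not (S a) ] * P + [ inQ a ] * (P ∸ 1)
                   ≤ count (λ b → G a b ∧ S b)
  S-degree a with v ≟ a
  ... | yes refl rewrite S-false⇒inQ-false (G-loopless v) =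
    ≤-reflexive (trans (+-identityʳ _) (trans (+-identityʳ _) (trans (+-identityʳ δ) (sum-cong-≗ {n} (cong [_] ∘ sym ∘ ∧-idem ∘ S)))))
  ... | no v≢a with S a in Sa
  ...   | false rewrite S-false⇒inQ-false Sa = let open CommonClique (commonClique (v≢a ∘ sym) Sa) in
    ≤-trans (≤-reflexive (trans (+-identityʳ _) (+-identityʳ P)))
      (count-injection _ vertex injective λ c → trans (cong₂ _∧_ (adjacentʳ c) (adjacentˡ c)) refl)
  ...   | true  with inQ a in Qa
  ...     | false = z≤n
  ...     | true  with c , refl ← inQ⇒vertex Qa =
    ≤-trans (≤-reflexive (+-identityʳ _)) (cliqueMap-degree G S (Q.injective , Q.clique) Q.adjacentˡ c)

  S-part : ℕ
  S-part = ∑[ a < n ] count (λ b → G a b ∧ S b)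

  nonS-part : ℕ
  nonS-part = ∑[ a < n ] count (λ b → G a b ∧ not (S b))

  S-part≥ : δ + r * P + P * (P ∸ 1) ≤ S-part
  S-part≥ = begin
    δ + r * P + P * (P ∸ 1)
      ≤⟨ +-monoʳ-≤ (δ + r * P) (*-monoˡ-≤ (P ∸ 1) P≤count-inQ) ⟩
    δ + r * P + count inQ * (P ∸ 1)
      ≡⟨ cong (λ z → z + r * P + count inQ * (P ∸ 1)) (trans (sym (*-identityˡ δ)) (cong (_* δ) (sym (count-singleton v)))) ⟩
    count (λ a → ⌊ v ≟ a ⌋) * δ + r * P + count inQ * (P ∸ 1)
      ≡⟨ cong₂ _+_ (cong₂ _+_ (*-distribʳ-sum {n} δ _) (*-distribʳ-sum {n} P _)) (*-distribʳ-sum {n} (P ∸ 1) _) ⟩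
    ∑[ a < n ] ([ ⌊ v ≟ a ⌋ ] * δ) + ∑[ a < n ] ([ nonNeighbour a ] * P) + ∑[ a < n ] ([ inQ a ] * (P ∸ 1))
      ≡⟨ sum₃ {n} _ _ _ ⟨
    ∑[ a < n ] ([ ⌊ v ≟ a ⌋ ] * δ + [ nonNeighbour a ] * P + [ inQ a ] * (P ∸ 1))
      ≤⟨ sum-mono-≤ S-degree ⟩
    S-part ∎
    where open ≤-Reasoning

  nonS-part≥ : suc r * δ ≤ nonS-part
  nonS-part≥ = begin
    suc r * δ                                            ≡⟨ cong (_* δ) count-not-S ⟨
    count (not ∘ S) * δ                                  ≡⟨ *-distribʳ-sum {n} δ _ ⟩
    ∑[ b < n ] ([ not (S b) ] * δ)                       ≤⟨ sum-mono-≤ degree ⟩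
    ∑[ b < n ] ∑[ a < n ] [ G a b ∧ not (S b) ]          ≡⟨ ∑-comm (λ a b → [ G a b ∧ not (S b) ]) ⟨
    nonS-part                                            ∎
    where
    open ≤-Reasoning
    degree : ∀ b → [ not (S b) ] * δ ≤ ∑[ a < n ] [ G a b ∧ not (S b) ]
    degree b with S b
    ... | true  = z≤n
    ... | false = begin
      δ + 0                          ≡⟨ +-identityʳ δ ⟩
      δ                              ≡⟨ deg≡count G v ⟨
      deg G v                        ≤⟨ v-minimum b ⟩
      deg G b                        ≡⟨ deg≡count G b ⟩
      count (G b)                    ≡⟨ sum-cong-≗ {n} (λ a → cong [_] (trans (G-sym b a) (sym (∧-identityʳ (G a b))))) ⟩
      ∑[ a < n ] [ G a b ∧ true ]    ∎

  degreeSum-G-split : degreeSum G ≡ S-part + nonS-part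
  degreeSum-G-split = trans (sum-cong-≗ {n} λ a → trans (sum-cong-≗ {n} (λ b → split (G a b) (S b))) (∑-distrib-+ {n} _ _))
                            (∑-distrib-+ {n} _ _)
    where
    split : ∀ x y → [ x ] ≡ [ x ∧ y ] + [ x ∧ not y ]
    split true  true  = refl
    split true  false = refl
    split false _     = refl

  lowerBound≤degreeSum : lowerBound P δ r ≤ degreeSum G
  lowerBound≤degreeSum = subst (lowerBound P δ r ≤_) (sym degreeSum-G-split) (+-mono-≤ S-part≥ nonS-part≥)

  nδ≤degreeSum : n * δ ≤ degreeSum G
  nδ≤degreeSum = subst (_≤ degreeSum G) (sum-const n δ)
    (sum-mono-≤ λ a → subst₂ _≤_ (deg≡count G v) (deg≡count G a) (v-minimum a))

  rest : ℕ
  rest = n + 3 ∸ 4 ∸ (p1 + p2 + p3 + p4)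

  M : ℕ
  M = p2 + 1 + (p3 + 1 + (p4 + 1 + rest))

  Y : Graph M
  Y = K (p2 + 1) ⊎G K (p3 + 1) ⊎G K (p4 + 1) ⊎G I rest

  H : Graph (P + M)
  H = Hgraph n p1 p2 p3 p4

  H-symmetric : Symmetric H
  H-symmetric = ∨G-symmetric (K P) Y K-symmetric
    (⊎G-symmetric (K (p2 + 1)) _ K-symmetric (⊎G-symmetric (K (p3 + 1)) _ K-symmetric
      (⊎G-symmetric (K (p4 + 1)) (I rest) K-symmetric I-symmetric)))

  degreeSum-Y : degreeSum Y ≡ Dq
  degreeSum-Y = begin
    degreeSum Y
      ≡⟨ degreeSum-⊎G (K (p2 + 1)) _ ⟩
    degreeSum (K (p2 + 1)) + degreeSum (K (p3 + 1) ⊎G K (p4 + 1) ⊎G I rest)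
      ≡⟨ cong (degreeSum (K (p2 + 1)) +_) (degreeSum-⊎G (K (p3 + 1)) _) ⟩
    degreeSum (K (p2 + 1)) + (degreeSum (K (p3 + 1)) + degreeSum (K (p4 + 1) ⊎G I rest))
      ≡⟨ cong (λ z → degreeSum (K (p2 + 1)) + (degreeSum (K (p3 + 1)) + z)) (degreeSum-⊎G (K (p4 + 1)) (I rest)) ⟩
    degreeSum (K (p2 + 1)) + (degreeSum (K (p3 + 1)) + (degreeSum (K (p4 + 1)) + degreeSum (I rest)))
      ≡⟨ cong₂ _+_ (K₊₁ p2) (cong₂ _+_ (K₊₁ p3) (cong₂ _+_ (K₊₁ p4) (degreeSum-I rest))) ⟩
    (p2 + 1) * p2 + ((p3 + 1) * p3 + ((p4 + 1) * p4 + 0))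
      ≡⟨ regroup p2 p3 p4 ⟩
    Dq ∎
    where
    open ≡-Reasoning
    K₊₁ : ∀ p → degreeSum (K (p + 1)) ≡ (p + 1) * p
    K₊₁ p = trans (degreeSum-K (p + 1)) (cong ((p + 1) *_) (m+n∸n≡m p 1))
    regroup : ∀ p2 p3 p4 → (p2 + 1) * p2 + ((p3 + 1) * p3 + ((p4 + 1) * p4 + 0)) ≡ p2 * (p2 + 1) + p3 * (p3 + 1) + p4 * (p4 + 1)
    regroup = solve-∀

  degreeSum-H : degreeSum H ≡ upperBound P M Dq
  degreeSum-H = trans (degreeSum-∨G (K P) Y) (cong₂ (λ x y → x + P * M + (M * P + y)) (degreeSum-K P) degreeSum-Y)

  degreeSum≤upperBound : degreeSum G ≤ upperBound P M Dq
  degreeSum≤upperBound = begin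
    degreeSum G     ≡⟨ handshake G-sym G-loopless ⟩
    e G + e G       ≤⟨ +-mono-≤ e-G≤e-H e-G≤e-H ⟩
    e H + e H       ≤⟨ e+e≤degreeSum H-symmetric ⟩
    degreeSum H     ≡⟨ degreeSum-H ⟩
    upperBound P M Dq ∎
    where open ≤-Reasoning

  M+P≡n : M + P ≡ n
  M+P≡n = Hgraph-size p1 p2 p3 p4 n 2≤p1 (≤-trans (s≤s (≤-trans (sum≤Dq p1 p2 p3 p4 p1≤p2) (m≤n+m Dq (3 * P)))) n-large)

  δ≤P : δ ≤ P
  δ≤P = bounds⇒δ≤P P δ r M Dq (trans M+P≡n n≡1+δ+r) (subst (3 * P + Dq <_) n≡1+δ+r n-large)
    (≤-trans (m∸n≤m p1 2) (≤-trans (m≤m+n p1 _) (≤-trans (m≤m+n _ p3) (≤-trans (m≤m+n _ p4) (sum≤Dq p1 p2 p3 p4 p1≤p2)))))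
    (≤-trans lowerBound≤degreeSum degreeSum≤upperBound)
    (subst (λ z → z * δ ≤ upperBound P M Dq) n≡1+δ+r (≤-trans nδ≤degreeSum degreeSum≤upperBound))

  -- With δ ≤ P, the P common neighbours of u and v exhaust S.
  nonNeighbour-complete-to-S : ∀ {u} → u ≢ v → S u ≡ false → ∀ s → S s ≡ true → G u s ≡ true
  nonNeighbour-complete-to-S {u} u≢v Su s Ss =
    let c , vertex-c≡s = count-injection-onto S vertex injective adjacentˡ δ≤P s Ss
    in subst (λ z → G u z ≡ true) vertex-c≡s (adjacentʳ c)
    where open CommonClique (commonClique u≢v Su)

  Outside : (Fin 3 → Subset n) → Fin n → Set
  Outside A a = a ≢ v × a ∉ N G v × (∀ j → a ∉ A j)

  family-containsWithin : ∀ {y A} → CliqueFamily G (q p2 p3 p4) v y A → ∀ j → ContainsWithin (K (q p2 p3 p4 j)) G (_∈ A j)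
  family-containsWithin {A = A} (size-clique , _) j with size-clique j
  ... | size , clique = subst (λ m → ContainsWithin (K m) G (_∈ A j)) size (subset-containsWithin G (A j) clique)

  -- Two adjacent outside vertices and Q form a K_{p1} disjoint from the three cliques of the family.
  noEdgeOutside : ∀ {y A} → CliqueFamily G (q p2 p3 p4) v y A → ∀ {a b} → Outside A a → Outside A b → a ≢ b → G a b ≢ true
  noEdgeOutside {A = A} A-family@(_ , A-disjoint , A-outside-S) {a} {b} (a≢v , a∉N , a∉A) (b≢v , b∉N , b∉A) a≢b Gab≡true =
    proj₁ G-saturated (ContainsWithin.contains F4-in-G)
    where
    b-Q : IsCliqueMap G (b Vector.∷ Q.vertex)
    b-Q = cliqueMap-∷ G-sym G-loopless b (Q.injective , Q.clique)
            λ c → nonNeighbour-complete-to-S b≢v (∉N⇒S-false b∉N) _ (Q.adjacentˡ c)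
    a-b-Q : IsCliqueMap G (a Vector.∷ b Vector.∷ Q.vertex)
    a-b-Q = cliqueMap-∷ G-sym G-loopless a b-Q λ where
      fz     → Gab≡true
      (fs c) → nonNeighbour-complete-to-S a≢v (∉N⇒S-false a∉N) _ (Q.adjacentˡ c)
    Q∉A : ∀ c j → Q.vertex c ∉ A j
    Q∉A c j Qc∈A = contradiction (trans (sym (Q.adjacentˡ c)) (∉N⇒S-false (proj₁ (A-outside-S j _ Qc∈A)))) λ ()
    core : ContainsWithin (K p1) G (λ z → ∀ j → z ∉ A j)
    core = subst (λ m → ContainsWithin (K m) G (λ z → ∀ j → z ∉ A j)) (m+[n∸m]≡n 2≤p1)
      (cliqueMap-containsWithin G a-b-Q λ where
        fz           → a∉A
        (fs fz)      → b∉A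
        (fs (fs c))  → Q∉A c)
    family : ContainsWithin (K p2 ⊎G K p3 ⊎G K p4) G (λ z → z ∈ A fz ⊎ z ∈ A (fs fz) ⊎ z ∈ A (fs (fs fz)))
    family = ⊎G-containsWithin (family-containsWithin A-family fz)
               (⊎G-containsWithin (family-containsWithin A-family (fs fz)) (family-containsWithin A-family (fs (fs fz)))
                 (A-disjoint (fs fz) (fs (fs fz)) λ ()))
               λ where z z∈A₀ (inj₁ z∈A₁) → A-disjoint fz (fs fz) (λ ()) z z∈A₀ z∈A₁
                       z z∈A₀ (inj₂ z∈A₂) → A-disjoint fz (fs (fs fz)) (λ ()) z z∈A₀ z∈A₂
    F4-in-G : ContainsWithin (F4 p1 p2 p3 p4) G _
    F4-in-G = ⊎G-containsWithin core family λ where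
      z z∉A (inj₁ z∈A₀)        → z∉A fz z∈A₀
      z z∉A (inj₂ (inj₁ z∈A₁)) → z∉A (fs fz) z∈A₁
      z z∉A (inj₂ (inj₂ z∈A₂)) → z∉A (fs (fs fz)) z∈A₂

  module _ {y y' : Fin n} {A B : Fin 3 → Subset n}
           (A-family : CliqueFamily G (q p2 p3 p4) v y A) (B-family : CliqueFamily G (q p2 p3 p4) v y' B) where

    ∣─⋃₃∣≤1 : ∀ j → ∣ A j ─ ⋃₃ B ∣ ≤ 1
    ∣─⋃₃∣≤1 j = ∣∣≤1 (A j ─ ⋃₃ B) unique
      where
      outside : ∀ {a} → a ∈ A j ─ ⋃₃ B → Outside B a
      outside {a} a∈ = let a∉N , a≢v , _ = proj₂ (proj₂ A-family) j a (p─q⊆p _ _ a∈) in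
                       a≢v , a∉N , ∉⋃₃ (x∈p─q⇒x∉q a∈)
      unique : ∀ a b → a ∈ A j ─ ⋃₃ B → b ∈ A j ─ ⋃₃ B → a ≡ b
      unique a b a∈ b∈ with a ≟ b
      ... | yes a≡b = a≡b
      ... | no  a≢b = contradiction (proj₂ (proj₁ A-family j) a b (p─q⊆p _ _ a∈) (p─q⊆p _ _ b∈) a≢b)
                        (noEdgeOutside B-family (outside a∈) (outside b∈) a≢b)

    row-partition : ∀ j → ∣ A j ∩ B fz ∣ + ∣ A j ∩ B (fs fz) ∣ + ∣ A j ∩ B (fs (fs fz)) ∣ + ∣ A j ─ ⋃₃ B ∣ ≡ q p2 p3 p4 j
    row-partition j = trans (∣∩∣-partition (A j) (B fz) (B (fs fz)) (B (fs (fs fz)))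
                               (B-disjoint fz (fs fz) λ ()) (B-disjoint fz (fs (fs fz)) λ ()) (B-disjoint (fs fz) (fs (fs fz)) λ ()))
                            (proj₁ (proj₁ A-family j))
      where B-disjoint = proj₁ (proj₂ B-family)

    column-partition : ∀ j → ∣ B fz ∩ A j ∣ + ∣ B (fs fz) ∩ A j ∣ + ∣ B (fs (fs fz)) ∩ A j ∣ + ∣ A j ─ ⋃₃ B ∣ ≡ q p2 p3 p4 j
    column-partition j rewrite ∩-comm (B fz) (A j) | ∩-comm (B (fs fz)) (A j) | ∩-comm (B (fs (fs fz))) (A j) = row-partition j

    ∣─⋃₃∣≡1 : ∀ {i} → y' ∈ A i → ∣ A i ─ ⋃₃ B ∣ ≡ 1
    ∣─⋃₃∣≡1 {i} y'∈Aᵢ = ≤-antisym (∣─⋃₃∣≤1 i) (≤-trans (s≤s z≤n) (x∈p⇒∣p-x∣<∣p∣ (x∈p∧x∉q⇒x∈p─q y'∈Aᵢ y'∉⋃B)))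
      where
      y'∉⋃B : y' ∉ ⋃₃ B
      y'∉⋃B y'∈⋃B = let j , y'∈Bⱼ = ∈⋃₃⁻ {A = B} y'∈⋃B in proj₂ (proj₂ (proj₂ (proj₂ B-family) j y' y'∈Bⱼ)) refl

  -- Both sides are Σ q minus the number of common vertices, counted along the rows and along the columns of the
  -- intersection matrix ∣ B a ∩ A b ∣.
  ∑₃-missed : ∀ {y y' A B} → CliqueFamily G (q p2 p3 p4) v y A → CliqueFamily G (q p2 p3 p4) v y' B →
              ∑₃ (λ j → ∣ A j ─ ⋃₃ B ∣) ≡ ∣ ⋃₃ B ─ ⋃₃ A ∣
  ∑₃-missed {A = A} {B} A-family B-family = +-cancelˡ-≡ (∑₃ col) _ _ (begin
    ∑₃ col + ∑₃ missedᴬ                     ≡⟨ interleave (col fz) (col (fs fz)) (col (fs (fs fz))) _ _ _ ⟩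
    ∑₃ (λ j → col j + missedᴬ j)            ≡⟨ cong₂ _+_ (cong₂ _+_ (colᵢ fz) (colᵢ (fs fz))) (colᵢ (fs (fs fz))) ⟩
    ∑₃ (q p2 p3 p4)                         ≡⟨ cong₂ _+_ (cong₂ _+_ (rowᵢ fz) (rowᵢ (fs fz))) (rowᵢ (fs (fs fz))) ⟨
    ∑₃ (λ j → row j + missedᴮ j)            ≡⟨ interleave (row fz) (row (fs fz)) (row (fs (fs fz))) _ _ _ ⟨
    ∑₃ row + ∑₃ missedᴮ                     ≡⟨ cong₂ _+_ rows≡cols (∣─∣-⋃₃ (B fz) (B (fs fz)) (B (fs (fs fz))) (⋃₃ A)
                                                (B-disjoint fz (fs fz) λ ()) (B-disjoint fz (fs (fs fz)) λ ())
                                                (B-disjoint (fs fz) (fs (fs fz)) λ ())) ⟩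
    ∑₃ col + ∣ ⋃₃ B ─ ⋃₃ A ∣                ∎)
    where
    open ≡-Reasoning
    ℓ : Fin 3 → Fin 3 → ℕ
    ℓ a b = ∣ B a ∩ A b ∣
    row col missedᴬ missedᴮ : Fin 3 → ℕ
    row j = ℓ j fz + ℓ j (fs fz) + ℓ j (fs (fs fz))
    col j = ℓ fz j + ℓ (fs fz) j + ℓ (fs (fs fz)) j
    missedᴬ j = ∣ A j ─ ⋃₃ B ∣
    missedᴮ j = ∣ B j ─ ⋃₃ A ∣
    B-disjoint = proj₁ (proj₂ B-family)
    colᵢ = column-partition A-family B-family
    rowᵢ = row-partition B-family A-family
    interleave : ∀ a₀ a₁ a₂ d₀ d₁ d₂ → a₀ + a₁ + a₂ + (d₀ + d₁ + d₂) ≡ (a₀ + d₀) + (a₁ + d₁) + (a₂ + d₂)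
    interleave = solve-∀
    rows≡cols : ∑₃ row ≡ ∑₃ col
    rows≡cols = transpose (ℓ fz fz) (ℓ fz (fs fz)) (ℓ fz (fs (fs fz))) (ℓ (fs fz) fz) (ℓ (fs fz) (fs fz))
                  (ℓ (fs fz) (fs (fs fz))) (ℓ (fs (fs fz)) fz) (ℓ (fs (fs fz)) (fs fz)) (ℓ (fs (fs fz)) (fs (fs fz)))
      where
      transpose : ∀ a₀₀ a₀₁ a₀₂ a₁₀ a₁₁ a₁₂ a₂₀ a₂₁ a₂₂ →
                  (a₀₀ + a₀₁ + a₀₂) + (a₁₀ + a₁₁ + a₁₂) + (a₂₀ + a₂₁ + a₂₂) ≡
                  (a₀₀ + a₁₀ + a₂₀) + (a₀₁ + a₁₁ + a₂₁) + (a₀₂ + a₁₂ + a₂₂)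
      transpose = solve-∀

lemma2p3 : (p1 p2 p3 p4 n : ℕ) → 2 ≤ p1 → p1 ≤ p2 → p2 ≤ p3 → p3 ≤ p4 →
  3 * (p1 ∸ 2) + (p2 * (p2 + 1) + p3 * (p3 + 1) + p4 * (p4 + 1)) < n →
  (G : Graph n) → IsSimple G → Saturated (F4 p1 p2 p3 p4) G →
  e G ≤ e (Hgraph n p1 p2 p3 p4) →
  (v : Fin n) → ((u : Fin n) → deg G v ≤ deg G u) →
  (w : Fin n) → w ∉ N G v → w ≢ v →
  (Hvw : Fin 3 → Subset n) → CliqueFamily G (q p2 p3 p4) v w Hvw →
  (i : Fin 3) → (x : Fin n) → x ∈ Hvw i →
  (Hvx : Fin 3 → Subset n) → CliqueFamily G (q p2 p3 p4) v x Hvx →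
  let ℓ : Fin 3 → Fin 3 → ℕ
      ℓ a b = ∣ Hvx a ∩ Hvw b ∣
      row : Fin 3 → ℕ
      row j = ℓ j fz + ℓ j (fs fz) + ℓ j (fs (fs fz))
      col : Fin 3 → ℕ
      col j = ℓ fz j + ℓ (fs fz) j + ℓ (fs (fs fz)) j
      VHvw : Subset n
      VHvw = Hvw fz ∪ Hvw (fs fz) ∪ Hvw (fs (fs fz))
      VHvx : Subset n
      VHvx = Hvx fz ∪ Hvx (fs fz) ∪ Hvx (fs (fs fz))
  in ((j : Fin 3) → q p2 p3 p4 j ∸ 1 ≤ row j × row j ≤ q p2 p3 p4 j)
     × ((j : Fin 3) → j ≢ i → q p2 p3 p4 j ∸ 1 ≤ col j × col j ≤ q p2 p3 p4 j)
     × (col i ≡ q p2 p3 p4 i ∸ 1)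
     × (∣ VHvx ─ VHvw ∣ ≡ 1 → (k : Fin 3) → k ≢ i → col k ≡ q p2 p3 p4 k)
lemma2p3 p1 p2 p3 p4 n 2≤p1 p1≤p2 p2≤p3 p3≤p4 n-large G G-simple G-saturated e-G≤e-H v v-minimum w w∉S w≢v
         Hvw Hvw-family i x x∈Hvwᵢ Hvx Hvx-family =
  (λ j → deficit≤1⇒bounds (row-partition Hvx-family Hvw-family j) (∣─⋃₃∣≤1 Hvx-family Hvw-family j)) ,
  (λ j _ → deficit≤1⇒bounds (column-partition Hvw-family Hvx-family j) (∣─⋃₃∣≤1 Hvw-family Hvx-family j)) ,
  trans (a+d≡q⇒a≡q∸d (column-partition Hvw-family Hvx-family i)) (cong (q p2 p3 p4 i ∸_) x-missed) ,
  λ one-new k k≢i → trans (a+d≡q⇒a≡q∸d (column-partition Hvw-family Hvx-family k))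
                          (cong (q p2 p3 p4 k ∸_) (∑₃≡1⇒others≡0 missed (trans (∑₃-missed Hvw-family Hvx-family) one-new) x-missed k≢i))
  where
  open Setting p1 p2 p3 p4 n 2≤p1 p1≤p2 p2≤p3 p3≤p4 n-large G G-simple G-saturated e-G≤e-H v v-minimum w w∉S w≢v
  missed : Fin 3 → ℕ
  missed j = ∣ Hvw j ─ ⋃₃ Hvx ∣
  x-missed : missed i ≡ 1
  x-missed = ∣─⋃₃∣≡1 Hvw-family Hvx-family x∈Hvwᵢ
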